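{- For every positive integer $g$ there exists $\varepsilon_g>0$ such that $b_\infty^{(g)}\le \frac{2-\varepsilon_g}{g}$.
   Context: A set $\mathcal{A}$ of integers is a $g$-thin Sidon set if for every integer $d$, the number of pairs $(a,b)\in\mathcal{A}^2$ with $a\ne b$ and $a-b=d$ is at most $g$. For a finite set $\mathcal{A}$, $\operatorname{diam}(\mathcal{A})=\max\mathcal{A}-\min\mathcal{A}$. For each $k\ge1$ let $\mathcal{A}_k^{(g)}$ be a $g$-thin Sidon set with $k$ elements and the minimum possible diameter among such sets, and define \[ b_\infty^{(g)}=\limsup_{k\to\infty}\frac{k^2/g-\operatorname{diam}(\mathcal{A}_k^{(g)})}{k^{3/2}}. \] -}

module Defs where

open import Data.Nat as ℕ using (ℕ; suc; _^_)
open import Data.Integer as ℤ using (ℤ; +_; _-_; _*_; _≤_)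
open import Data.Integer.Properties using () renaming (_≟_ to _≟ℤ_)
open import Data.List using (List; length; filter; cartesianProduct)
open import Data.List.Relation.Unary.All using (All)
open import Data.List.Relation.Unary.Unique.Propositional using (Unique)
open import Data.List.Membership.Propositional using (_∈_)
open import Data.Product using (Σ; ∃; _×_; _,_)
open import Data.Sum using (_⊎_)
open import Relation.Nullary using (¬?)
open import Relation.Nullary.Decidable using (_×-dec_)

-- A finite set of integers is represented by a duplicate-free list (Unique A).

pairCount : List ℤ → ℤ → ℕ
pairCount A d =
  length (filter (λ p → ¬? (Data.Product.proj₁ p ≟ℤ Data.Product.proj₂ p)
                        ×-dec ((Data.Product.proj₁ p - Data.Product.proj₂ p) ≟ℤ d))
                 (cartesianProduct A A))

Thin : ℕ → List ℤ → Set
Thin g A = ∀ (d : ℤ) → pairCount A d ℕ.≤ g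

HasDiam : List ℤ → ℕ → Set
HasDiam A D = ∃ λ (m : ℤ) → (m ∈ A) × ((m ℤ.+ + D) ∈ A)
                          × All (λ a → (m ≤ a) × (a ≤ m ℤ.+ + D)) A

IsMinDiam : ℕ → ℕ → ℕ → Set
IsMinDiam g k D =
  (∃ λ (A : List ℤ) → Unique A × (length A ≡ k) × Thin g A × HasDiam A D)
  × (∀ (A : List ℤ) (D′ : ℕ) → Unique A → length A ≡ k → Thin g A
       → HasDiam A D′ → D ℕ.≤ D′)
  where open import Relation.Binary.PropositionalEquality using (_≡_)

-- The real inequality  n · (k² - g·D) ≤ (2n - 1) · k^(3/2),
-- i.e.  (k²/g - D) / k^(3/2) ≤ (2 - 1/n) / g,
-- stated over ℤ: with L = n·(k² - g·D) and c = 2n - 1 ≥ 0 it reads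
-- L ≤ 0  or  L² ≤ c² · k³.
BoundAt : ℕ → ℕ → ℕ → ℕ → Set
BoundAt g n k D =
  (L ≤ + 0) ⊎ ((L * L) ≤ + ((c ℕ.* c) ℕ.* (k ^ 3)))
  where
    L : ℤ
    L = + n * (+ (k ℕ.* k) - + (g ℕ.* D))
    c : ℕ
    c = 2 ℕ.* n ℕ.∸ 1

-- Shift a g-thin set of k integers into [0, D] and let W(t) count its points in the window
-- [t - w, t).  Summed over t the counts total k w, and their squares total at most k w + g w²:
-- the overlap of the windows around x and y depends only on x - y, the overlaps over all
-- differences sum to w², and each nonzero difference occurs at most g times.  Expanding
-- ∑ (W(t) - s)² with s ≈ √k and g w ≈ s k, the main terms cancel to a perfect square and what
-- is left reads (k² - g D) s² + g ∑ (W(t) - s)² ≲ 2 s³ k, the classical k² - g D ≲ 2 k^(3/2)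
-- plus a correction.  The gain is a lower bound of order s³ k / g for that sum of squares.
-- Either the counts W(t) miss s by at least s / q along a stretch of length w / b at the start,
-- just before w or just after w, which is enough directly; or the set has about s points near 0,
-- about s more near w and almost none in between, and then windows of length w / r around one
-- cluster hold r times their share of points, which the second-moment bound rules out.

module Submission where

open import Defs
open import Data.Nat using (ℕ; _≤_)
open import Data.Product using (∃; _×_)

open import Data.Bool using (true; false; if_then_else_)
open import Data.Empty using (⊥; ⊥-elim)
open import Data.Unit using (tt)
open import Data.Nat hiding (ℕ; _≤_)
open import Data.Nat.Properties
open import Data.Nat.DivMod using (_/_; _%_; m≡m%n+[m/n]*n; m%n<n; m≥n⇒m/n>0)
open import Data.Nat.ListAction using (sum)
open import Data.Nat.ListAction.Properties using (sum-++)
open import Data.Nat.Tactic.RingSolver using (solve-∀)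
open import Data.Integer as ℤ using (ℤ)
import Data.Integer.Properties as ℤ
import Data.Integer.Tactic.RingSolver as ℤ-RingSolver
open import Data.List using (List; []; _∷_; _++_; map; length; filter; cartesianProduct)
open import Data.List.Properties using (map-cong; map-∘; map-++; length-map)
open import Data.List.Membership.Propositional using (_∈_)
open import Data.List.Relation.Unary.All as All using (All; []; _∷_)
open import Data.List.Relation.Unary.All.Properties as All using ()
open import Data.List.Relation.Unary.AllPairs using ([]; _∷_)
open import Data.List.Relation.Unary.Any using (here; there)
open import Data.List.Relation.Unary.Unique.Propositional using (Unique)
open import Data.Product using (_,_; proj₁; proj₂)
open import Data.Sum using (_⊎_; inj₁; inj₂; [_,_]′)
open import Function using (_∘_)
open import Relation.Binary.PropositionalEquality
open import Relation.Nullary using (Dec; yes; no; does; ¬_; ¬?; contradiction)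
open import Relation.Nullary.Decidable using (_×-dec_; dec-true; dec-false)
open import Algebra.Properties.CommutativeSemigroup +-commutativeSemigroup using (interchange)

-- Iverson brackets and finite sums

𝟙 : {A : Set} → Dec A → ℕ
𝟙 a? = if does a? then 1 else 0

𝟙-yes : {A : Set} (a? : Dec A) → A → 𝟙 a? ≡ 1
𝟙-yes a? a rewrite dec-true a? a = refl

𝟙-no : {A : Set} (a? : Dec A) → ¬ A → 𝟙 a? ≡ 0
𝟙-no a? ¬a rewrite dec-false a? ¬a = refl

𝟙-⇔ : {A B : Set} (a? : Dec A) (b? : Dec B) → (A → B) → (B → A) → 𝟙 a? ≡ 𝟙 b?
𝟙-⇔ (yes a) b? to from = sym (𝟙-yes b? (to a))
𝟙-⇔ (no ¬a) b? to from = sym (𝟙-no b? (¬a ∘ from))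

𝟙-mono : {A B : Set} (a? : Dec A) (b? : Dec B) → (A → B) → 𝟙 a? ≤ 𝟙 b?
𝟙-mono (yes a) b? to = ≤-reflexive (sym (𝟙-yes b? (to a)))
𝟙-mono (no _) b? to = z≤n

𝟙+𝟙¬ : {A : Set} (a? : Dec A) → 𝟙 a? + 𝟙 (¬? a?) ≡ 1
𝟙+𝟙¬ (yes _) = refl
𝟙+𝟙¬ (no _) = refl

∑< : ℕ → (ℕ → ℕ) → ℕ
∑< zero f = 0
∑< (suc n) f = f 0 + ∑< n (f ∘ suc)

syntax ∑< n (λ i → e) = ∑[ i < n ] e

∑∈ : {A : Set} → List A → (A → ℕ) → ℕ
∑∈ xs f = sum (map f xs)

syntax ∑∈ xs (λ x → e) = ∑[ x ∈ xs ] e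

∑<-cong : ∀ n {f h : ℕ → ℕ} → (∀ i → i < n → f i ≡ h i) → ∑< n f ≡ ∑< n h
∑<-cong zero eq = refl
∑<-cong (suc n) eq = cong₂ _+_ (eq 0 z<s) (∑<-cong n (λ i i<n → eq (suc i) (s<s i<n)))

∑<-mono : ∀ n {f h : ℕ → ℕ} → (∀ i → i < n → f i ≤ h i) → ∑< n f ≤ ∑< n h
∑<-mono zero le = z≤n
∑<-mono (suc n) le = +-mono-≤ (le 0 z<s) (∑<-mono n (λ i i<n → le (suc i) (s<s i<n)))

∑<-split : ∀ m n (f : ℕ → ℕ) → ∑< (m + n) f ≡ ∑< m f + ∑[ i < n ] f (m + i)
∑<-split zero n f = refl
∑<-split (suc m) n f = trans (cong (f 0 +_) (∑<-split m n (f ∘ suc))) (sym (+-assoc (f 0) _ _))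

∑<-const : ∀ n c → ∑[ i < n ] c ≡ n * c
∑<-const zero c = refl
∑<-const (suc n) c = cong (c +_) (∑<-const n c)

∑<-zero : ∀ n {f : ℕ → ℕ} → (∀ i → i < n → f i ≡ 0) → ∑< n f ≡ 0
∑<-zero n eq = trans (∑<-cong n eq) (trans (∑<-const n 0) (*-zeroʳ n))

∑<-distrib-+ : ∀ n (f h : ℕ → ℕ) → ∑[ i < n ] (f i + h i) ≡ ∑< n f + ∑< n h
∑<-distrib-+ zero f h = refl
∑<-distrib-+ (suc n) f h = trans (cong (f 0 + h 0 +_) (∑<-distrib-+ n (f ∘ suc) (h ∘ suc))) (interchange (f 0) (h 0) _ _)

∑<-*ˡ : ∀ n c (f : ℕ → ℕ) → ∑[ i < n ] (c * f i) ≡ c * ∑< n f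
∑<-*ˡ zero c f = sym (*-zeroʳ c)
∑<-*ˡ (suc n) c f = trans (cong (c * f 0 +_) (∑<-*ˡ n c (f ∘ suc))) (sym (*-distribˡ-+ c (f 0) _))

∑<-comm : ∀ m n (f : ℕ → ℕ → ℕ) → ∑[ i < m ] ∑[ j < n ] f i j ≡ ∑[ j < n ] ∑[ i < m ] f i j
∑<-comm zero n f = sym (trans (∑<-const n 0) (*-zeroʳ n))
∑<-comm (suc m) n f = trans (cong (∑< n (f 0) +_) (∑<-comm m n (f ∘ suc))) (sym (∑<-distrib-+ n (f 0) _))

∑∈-cong : {A : Set} (xs : List A) {f h : A → ℕ} → All (λ x → f x ≡ h x) xs → ∑∈ xs f ≡ ∑∈ xs h
∑∈-cong [] [] = refl
∑∈-cong (x ∷ xs) (eq ∷ eqs) = cong₂ _+_ eq (∑∈-cong xs eqs)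

∑∈-cong′ : {A : Set} (xs : List A) {f h : A → ℕ} → (∀ x → f x ≡ h x) → ∑∈ xs f ≡ ∑∈ xs h
∑∈-cong′ xs eq = cong sum (map-cong eq xs)

∑∈-mono : {A : Set} (xs : List A) {f h : A → ℕ} → All (λ x → f x ≤ h x) xs → ∑∈ xs f ≤ ∑∈ xs h
∑∈-mono [] [] = z≤n
∑∈-mono (x ∷ xs) (le ∷ les) = +-mono-≤ le (∑∈-mono xs les)

∑∈-distrib-+ : {A : Set} (xs : List A) (f h : A → ℕ) → ∑[ x ∈ xs ] (f x + h x) ≡ ∑∈ xs f + ∑∈ xs h
∑∈-distrib-+ [] f h = refl
∑∈-distrib-+ (x ∷ xs) f h = trans (cong (f x + h x +_) (∑∈-distrib-+ xs f h)) (interchange (f x) (h x) _ _)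

∑∈-*ˡ : {A : Set} (xs : List A) (c : ℕ) (f : A → ℕ) → ∑[ x ∈ xs ] (c * f x) ≡ c * ∑∈ xs f
∑∈-*ˡ [] c f = sym (*-zeroʳ c)
∑∈-*ˡ (x ∷ xs) c f = trans (cong (c * f x +_) (∑∈-*ˡ xs c f)) (sym (*-distribˡ-+ c (f x) _))

∑∈-*ʳ : {A : Set} (xs : List A) (c : ℕ) (f : A → ℕ) → ∑[ x ∈ xs ] (f x * c) ≡ ∑∈ xs f * c
∑∈-*ʳ xs c f = trans (∑∈-cong′ xs (λ x → *-comm (f x) c)) (trans (∑∈-*ˡ xs c f) (*-comm c _))

∑∈-const : {A : Set} (xs : List A) (c : ℕ) → ∑[ x ∈ xs ] c ≡ length xs * c
∑∈-const [] c = refl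
∑∈-const (x ∷ xs) c = cong (c +_) (∑∈-const xs c)

∑∈-map : {A B : Set} (g : A → B) (xs : List A) (f : B → ℕ) → ∑∈ (map g xs) f ≡ ∑∈ xs (f ∘ g)
∑∈-map g xs f = cong sum (sym (map-∘ xs))

∑∈-++ : {A : Set} (xs ys : List A) (f : A → ℕ) → ∑∈ (xs ++ ys) f ≡ ∑∈ xs f + ∑∈ ys f
∑∈-++ xs ys f = trans (cong sum (map-++ f xs ys)) (sum-++ (map f xs) (map f ys))

∑∈-comm : {A B : Set} (xs : List A) (ys : List B) (f : A → B → ℕ) →
          ∑[ x ∈ xs ] ∑[ y ∈ ys ] f x y ≡ ∑[ y ∈ ys ] ∑[ x ∈ xs ] f x y
∑∈-comm [] ys f = sym (trans (∑∈-const ys 0) (*-zeroʳ (length ys)))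
∑∈-comm (x ∷ xs) ys f = trans (cong (∑∈ ys (f x) +_) (∑∈-comm xs ys f)) (sym (∑∈-distrib-+ ys (f x) _))

∑<-∑∈-comm : ∀ n {A : Set} (xs : List A) (f : ℕ → A → ℕ) →
             ∑[ i < n ] ∑[ x ∈ xs ] f i x ≡ ∑[ x ∈ xs ] ∑[ i < n ] f i x
∑<-∑∈-comm zero xs f = sym (trans (∑∈-const xs 0) (*-zeroʳ (length xs)))
∑<-∑∈-comm (suc n) xs f = trans (cong (∑∈ xs (f 0) +_) (∑<-∑∈-comm n xs (f ∘ suc))) (sym (∑∈-distrib-+ xs (f 0) _))

∑<-≥-interval : ∀ N x L (f : ℕ → ℕ) c → x + L ≤ N → (∀ i → i < L → c ≤ f (x + i)) → L * c ≤ ∑< N f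
∑<-≥-interval N x L f c x+L≤N c≤f = begin
  L * c                                                   ≡⟨ sym (∑<-const L c) ⟩
  ∑[ i < L ] c                                            ≤⟨ ∑<-mono L c≤f ⟩
  ∑[ i < L ] f (x + i)                                    ≤⟨ m≤m+n _ _ ⟩
  ∑[ i < L ] f (x + i) + ∑[ i < e ] f (x + (L + i))       ≡⟨ sym (∑<-split L e (λ i → f (x + i))) ⟩
  ∑[ i < L + e ] f (x + i)                                ≤⟨ m≤n+m _ (∑< x f) ⟩
  ∑< x f + ∑[ i < L + e ] f (x + i)                       ≡⟨ sym (∑<-split x (L + e) f) ⟩
  ∑< (x + (L + e)) f                                      ≡⟨ cong (λ n → ∑< n f) (trans (sym (+-assoc x L e)) (m+[n∸m]≡n x+L≤N)) ⟩
  ∑< N f                                                  ∎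
  where
  open ≤-Reasoning
  e : ℕ
  e = N ∸ (x + L)

∑<-≥-two-intervals : ∀ N x y L (f : ℕ → ℕ) c → x + L ≤ y → y + L ≤ N →
                     (∀ i → i < L → c ≤ f (x + i)) → (∀ i → i < L → c ≤ f (y + i)) → 2 * (L * c) ≤ ∑< N f
∑<-≥-two-intervals N x y L f c x+L≤y y+L≤N c≤f₁ c≤f₂ = begin
  2 * (L * c)                              ≡⟨ cong (L * c +_) (+-identityʳ (L * c)) ⟩
  L * c + L * c                            ≤⟨ +-mono-≤ (∑<-≥-interval y x L f c x+L≤y c≤f₁)
                                                       (∑<-≥-interval (N ∸ y) 0 L (λ i → f (y + i)) c (m+n≤o⇒m≤o∸n L (subst (_≤ N) (+-comm y L) y+L≤N)) c≤f₂) ⟩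
  ∑< y f + ∑[ i < N ∸ y ] f (y + i)        ≡⟨ sym (∑<-split y (N ∸ y) f) ⟩
  ∑< (y + (N ∸ y)) f                       ≡⟨ cong (λ n → ∑< n f) (m+[n∸m]≡n (≤-trans (m≤m+n y L) y+L≤N)) ⟩
  ∑< N f                                   ∎
  where open ≤-Reasoning

length-filter≡∑𝟙 : {A : Set} {P : A → Set} (P? : ∀ x → Dec (P x)) (xs : List A) → length (filter P? xs) ≡ ∑[ x ∈ xs ] 𝟙 (P? x)
length-filter≡∑𝟙 P? [] = refl
length-filter≡∑𝟙 P? (x ∷ xs) with does (P? x)
... | true = cong suc (length-filter≡∑𝟙 P? xs)
... | false = length-filter≡∑𝟙 P? xs

∑-cartesianProduct : {A B : Set} (xs : List A) (ys : List B) (f : A × B → ℕ) →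
                     ∑∈ (cartesianProduct xs ys) f ≡ ∑[ x ∈ xs ] ∑[ y ∈ ys ] f (x , y)
∑-cartesianProduct [] ys f = refl
∑-cartesianProduct (x ∷ xs) ys f =
  trans (∑∈-++ (map (x ,_) ys) (cartesianProduct xs ys) f) (cong₂ _+_ (∑∈-map (x ,_) ys f) (∑-cartesianProduct xs ys f))

∑-𝟙≟-absent : ∀ {x} (ys : List ℕ) → All (x ≢_) ys → ∑[ y ∈ ys ] 𝟙 (x ≟ y) ≡ 0
∑-𝟙≟-absent [] [] = refl
∑-𝟙≟-absent (y ∷ ys) (x≢y ∷ x∉ys) = cong₂ _+_ (𝟙-no (_ ≟ y) x≢y) (∑-𝟙≟-absent ys x∉ys)

∑-𝟙≟-unique : ∀ {x} (ys : List ℕ) → Unique ys → x ∈ ys → ∑[ y ∈ ys ] 𝟙 (x ≟ y) ≡ 1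
∑-𝟙≟-unique (y ∷ ys) (y∉ys ∷ _) (here refl) = cong₂ _+_ (𝟙-yes (y ≟ y) refl) (∑-𝟙≟-absent ys y∉ys)
∑-𝟙≟-unique (y ∷ ys) (y∉ys ∷ u) (there x∈ys) =
  cong₂ _+_ (𝟙-no (_ ≟ y) (λ x≡y → All.lookup y∉ys x∈ys (sym x≡y))) (∑-𝟙≟-unique ys u x∈ys)

[_,_[ : ℕ → ℕ → ℕ → ℕ
[ a , b [ t = 𝟙 (a ≤? t ×-dec t <? b)

module _ (a b : ℕ) {t : ℕ} where

  [,[-inside : a ≤ t → t < b → [ a , b [ t ≡ 1
  [,[-inside a≤t t<b = 𝟙-yes (a ≤? t ×-dec t <? b) (a≤t , t<b)

  [,[-below : t < a → [ a , b [ t ≡ 0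
  [,[-below t<a = 𝟙-no (a ≤? t ×-dec t <? b) (<⇒≱ t<a ∘ proj₁)

  [,[-above : b ≤ t → [ a , b [ t ≡ 0
  [,[-above b≤t = 𝟙-no (a ≤? t ×-dec t <? b) (≤⇒≯ b≤t ∘ proj₂)

[,[-shift : ∀ c a b t → [ c + a , c + b [ (c + t) ≡ [ a , b [ t
[,[-shift c a b t = 𝟙-⇔ (c + a ≤? c + t ×-dec c + t <? c + b) (a ≤? t ×-dec t <? b)
  (λ (p , q) → +-cancelˡ-≤ c a t p , +-cancelˡ-< c t b q)
  (λ (p , q) → +-monoʳ-≤ c p , +-monoʳ-< c q)

∑<-[,[ : ∀ N a len (f : ℕ → ℕ) → a + len ≤ N → ∑[ j < N ] ([ a , a + len [ j * f j) ≡ ∑[ i < len ] f (a + i)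
∑<-[,[ N a len f a+len≤N = begin
  ∑< N F                                                    ≡⟨ cong (λ n → ∑< n F) (sym N≡) ⟩
  ∑< (a + (len + e)) F                                      ≡⟨ ∑<-split a (len + e) F ⟩
  ∑< a F + ∑[ i < len + e ] F (a + i)                        ≡⟨ cong (∑< a F +_) (∑<-split len e (λ i → F (a + i))) ⟩
  ∑< a F + (∑[ i < len ] F (a + i) + ∑[ i < e ] F (a + (len + i)))
    ≡⟨ cong₂ (λ x y → x + (y + ∑[ i < e ] F (a + (len + i)))) before inside ⟩
  ∑[ i < len ] f (a + i) + ∑[ i < e ] F (a + (len + i))     ≡⟨ cong (∑[ i < len ] f (a + i) +_) after ⟩
  ∑[ i < len ] f (a + i) + 0                                ≡⟨ +-identityʳ _ ⟩
  ∑[ i < len ] f (a + i)                                    ∎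
  where
  open ≡-Reasoning
  F : ℕ → ℕ
  F j = [ a , a + len [ j * f j
  e : ℕ
  e = N ∸ (a + len)
  N≡ : a + (len + e) ≡ N
  N≡ = trans (sym (+-assoc a len e)) (m+[n∸m]≡n a+len≤N)
  before : ∑< a F ≡ 0
  before = ∑<-zero a (λ i i<a → cong (_* f i) ([,[-below a (a + len) i<a))
  inside : ∑[ i < len ] F (a + i) ≡ ∑[ i < len ] f (a + i)
  inside = ∑<-cong len (λ i i<len → trans (cong (_* f (a + i)) ([,[-inside a (a + len) (m≤m+n a i) (+-monoʳ-< a i<len))) (*-identityˡ _))
  after : ∑[ i < e ] F (a + (len + i)) ≡ 0
  after = ∑<-zero e (λ i _ → cong (_* f (a + (len + i))) ([,[-above a (a + len) (+-monoʳ-≤ a (m≤m+n len i))))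

∑<-[,[-count : ∀ N a len → a + len ≤ N → ∑[ j < N ] [ a , a + len [ j ≡ len
∑<-[,[-count N a len a+len≤N = begin
  ∑[ j < N ] [ a , a + len [ j            ≡⟨ ∑<-cong N (λ j _ → sym (*-identityʳ _)) ⟩
  ∑[ j < N ] ([ a , a + len [ j * 1)      ≡⟨ ∑<-[,[ N a len (λ _ → 1) a+len≤N ⟩
  ∑[ i < len ] 1                          ≡⟨ trans (∑<-const len 1) (*-identityʳ len) ⟩
  len                                     ∎
  where open ≡-Reasoning

∑<-point : ∀ N J (f : ℕ → ℕ) → J < N → ∑[ j < N ] ([ J , J + 1 [ j * f j) ≡ f J
∑<-point N J f J<N = begin
  ∑[ j < N ] ([ J , J + 1 [ j * f j)   ≡⟨ ∑<-[,[ N J 1 f (subst (_≤ N) (+-comm 1 J) J<N) ⟩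
  f (J + 0) + 0                        ≡⟨ trans (+-identityʳ _) (cong f (+-identityʳ J)) ⟩
  f J                                  ∎
  where open ≡-Reasoning

[n∸m]²+2mn≡m²+n² : ∀ {m n} → m ≤ n → (n ∸ m) * (n ∸ m) + 2 * (m * n) ≡ m * m + n * n
[n∸m]²+2mn≡m²+n² {m} {n} m≤n = begin
  e * e + 2 * (m * n)          ≡⟨ cong (λ z → e * e + 2 * (m * z)) (sym n≡m+e) ⟩
  e * e + 2 * (m * (m + e))    ≡⟨ expand m e ⟩
  m * m + (m + e) * (m + e)    ≡⟨ cong (λ z → m * m + z * z) n≡m+e ⟩
  m * m + n * n                ∎
  where
  open ≡-Reasoning
  e : ℕ
  e = n ∸ m
  n≡m+e : m + e ≡ n
  n≡m+e = m+[n∸m]≡n m≤n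
  expand : ∀ m e → e * e + 2 * (m * (m + e)) ≡ m * m + (m + e) * (m + e)
  expand = solve-∀

∣m-n∣²+2mn≡m²+n² : ∀ m n → ∣ m - n ∣ * ∣ m - n ∣ + 2 * (m * n) ≡ m * m + n * n
∣m-n∣²+2mn≡m²+n² m n with ≤-total m n
... | inj₁ m≤n rewrite m≤n⇒∣m-n∣≡n∸m m≤n = [n∸m]²+2mn≡m²+n² m≤n
... | inj₂ n≤m rewrite m≤n⇒∣n-m∣≡n∸m n≤m | *-comm m n | +-comm (m * m) (n * n) = [n∸m]²+2mn≡m²+n² n≤m

m+p≤n⇒p≤∣m-n∣ : ∀ {m n p} → m + p ≤ n → p ≤ ∣ m - n ∣
m+p≤n⇒p≤∣m-n∣ {m} {n} {p} m+p≤n = ≤-trans (m+n≤o⇒m≤o∸n p (subst (_≤ n) (+-comm m p) m+p≤n)) (subst (n ∸ m ≤_) (∣-∣-comm n m) (m∸n≤∣m-n∣ n m))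

n+p≤m⇒p≤∣m-n∣ : ∀ {m n p} → n + p ≤ m → p ≤ ∣ m - n ∣
n+p≤m⇒p≤∣m-n∣ {m} {n} {p} n+p≤m = ≤-trans (m+n≤o⇒m≤o∸n p (subst (_≤ m) (+-comm n p) n+p≤m)) (m∸n≤∣m-n∣ m n)

z²+y²≡2zy+ρ² : ∀ {y ρ z} → y + ρ ≡ z → z * z + y * y ≡ 2 * z * y + ρ * ρ
z²+y²≡2zy+ρ² {y} {ρ} refl = expand y ρ
  where
  expand : ∀ y ρ → (y + ρ) * (y + ρ) + y * y ≡ 2 * (y + ρ) * y + ρ * ρ
  expand = solve-∀

-‿cancelʳ-≡ : ∀ {i i′} j → i ℤ.- j ≡ i′ ℤ.- j → i ≡ i′
-‿cancelʳ-≡ {i} {i′} j eq = trans (sym (restore i j)) (trans (cong (ℤ._+ j) eq) (restore i′ j))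
  where
  restore : ∀ i j → i ℤ.- j ℤ.+ j ≡ i
  restore = ℤ-RingSolver.solve-∀

+n*[+a-+b]≡+[n*[a∸b]] : ∀ n {a b} → b ≤ a → ℤ.+ n ℤ.* (ℤ.+ a ℤ.- ℤ.+ b) ≡ ℤ.+ (n * (a ∸ b))
+n*[+a-+b]≡+[n*[a∸b]] n {a} {b} b≤a = trans (cong (ℤ.+ n ℤ.*_) (trans (ℤ.m-n≡m⊖n a b) (ℤ.⊖-≥ b≤a))) (sym (ℤ.pos-* n (a ∸ b)))

+n*[+a-+b]≤0 : ∀ n {a b} → a ≤ b → ℤ.+ n ℤ.* (ℤ.+ a ℤ.- ℤ.+ b) ℤ.≤ ℤ.+ 0
+n*[+a-+b]≤0 n a≤b = ℤ.≤-trans (ℤ.*-monoˡ-≤-nonNeg (ℤ.+ n) (ℤ.i≤j⇒i-j≤0 (ℤ.+≤+ a≤b))) (ℤ.≤-reflexive (ℤ.*-zeroʳ (ℤ.+ n)))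

between-squares : ∀ q → 1 ≤ q → ∀ k → ∃ λ t → (q * t * (q * t) ≤ k) × (k < q * (t + 1) * (q * (t + 1)))
between-squares q 1≤q zero = 0 , ≤-reflexive (cong (λ z → z * z) (*-zeroʳ q)) , *-mono-≤ q≥1 q≥1
  where
  q≥1 : 1 ≤ q * (0 + 1)
  q≥1 = subst (1 ≤_) (sym (*-identityʳ q)) 1≤q
between-squares q 1≤q (suc k) with between-squares q 1≤q k
... | t , lower , upper with q * (t + 1) * (q * (t + 1)) ≤? suc k
...   | yes next≤ = t + 1 , next≤ , ≤-trans (s≤s upper) (*-mono-< qt<qt′ qt<qt′)
  where
  qt<qt′ : q * (t + 1) < q * (t + 1 + 1)
  qt<qt′ = *-monoʳ-< q {{>-nonZero 1≤q}} (subst (t + 1 <_) (+-comm 1 (t + 1)) ≤-refl)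
...   | no next≰ = t , ≤-trans lower (n≤1+n k) , ≰⇒> next≰

c²k³<L²⇒c[sk]<L : ∀ c s k L → s * s ≤ k → c * c * k ^ 3 < L * L → c * (s * k) < L
c²k³<L²⇒c[sk]<L c s k L s²≤k c²k³<L² with c * (s * k) <? L
... | yes c[sk]<L = c[sk]<L
... | no c[sk]≮L = contradiction c²k³<L² (≤⇒≯ (begin
  L * L                          ≤⟨ *-mono-≤ L≤c[sk] L≤c[sk] ⟩
  c * (s * k) * (c * (s * k))    ≡⟨ regroup c s k ⟩
  c * c * (s * s * (k * k))      ≤⟨ *-monoʳ-≤ (c * c) (*-monoˡ-≤ (k * k) s²≤k) ⟩
  c * c * (k * (k * k))          ≡⟨ cong (λ z → c * c * (k * (k * z))) (sym (*-identityʳ k)) ⟩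
  c * c * k ^ 3                  ∎))
  where
  open ≤-Reasoning
  L≤c[sk] : L ≤ c * (s * k)
  L≤c[sk] = ≮⇒≥ c[sk]≮L
  regroup : ∀ c s k → c * (s * k) * (c * (s * k)) ≡ c * c * (s * s * (k * k))
  regroup = solve-∀

-- Thin sets of integers as configurations in [0, D]

record ThinConfiguration (g D : ℕ) (E : List ℕ) : Set where
  field
    bounded : All (_≤ D) E
    unique : Unique E
    -- x + D ∸ y encodes the difference x - y ∈ [-D, D] as an index in [0, 2D].
    thin : ∀ (H : ℕ → ℕ) → ∑[ x ∈ E ] ∑[ y ∈ E ] (𝟙 (¬? (x ≟ y)) * H (x + D ∸ y)) ≤ g * ∑< (suc (D + D)) H

pairCount≡∑ : ∀ A d → pairCount A d ≡ ∑[ a ∈ A ] ∑[ b ∈ A ] 𝟙 (¬? (a ℤ.≟ b) ×-dec (a ℤ.- b ℤ.≟ d))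
pairCount≡∑ A d = trans (length-filter≡∑𝟙 _ (cartesianProduct A A)) (∑-cartesianProduct A A _)

module Offsets (m : ℤ) (D : ℕ) where

  InRange : ℤ → Set
  InRange a = (m ℤ.≤ a) × (a ℤ.≤ m ℤ.+ ℤ.+ D)

  offset : ℤ → ℕ
  offset a = ℤ.∣ a ℤ.- m ∣

  shifted : ℕ → ℤ
  shifted j = ℤ.+ j ℤ.- ℤ.+ D

  +offset : ∀ {a} → m ℤ.≤ a → ℤ.+ offset a ≡ a ℤ.- m
  +offset m≤a = ℤ.0≤i⇒+∣i∣≡i (ℤ.i≤j⇒0≤j-i m≤a)

  offset≤D : ∀ {a} → InRange a → offset a ≤ D
  offset≤D {a} (m≤a , a≤m+D) = ℤ.drop‿+≤+ (begin
    ℤ.+ offset a           ≡⟨ +offset m≤a ⟩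
    a ℤ.- m                ≤⟨ ℤ.+-monoˡ-≤ (ℤ.- m) a≤m+D ⟩
    m ℤ.+ ℤ.+ D ℤ.- m      ≡⟨ cancel m (ℤ.+ D) ⟩
    ℤ.+ D                  ∎)
    where
    open ℤ.≤-Reasoning
    cancel : ∀ m d → m ℤ.+ d ℤ.- m ≡ d
    cancel = ℤ-RingSolver.solve-∀

  offset-injective : ∀ {a b} → m ℤ.≤ a → m ℤ.≤ b → offset a ≡ offset b → a ≡ b
  offset-injective m≤a m≤b eq = -‿cancelʳ-≡ m (trans (sym (+offset m≤a)) (trans (cong ℤ.+_ eq) (+offset m≤b)))

  difference≡ : ∀ {a b} → InRange a → InRange b → a ℤ.- b ≡ shifted (offset a + D ∸ offset b)
  difference≡ {a} {b} (m≤a , _) b-range = begin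
    a ℤ.- b                                           ≡⟨ sym (shift a b m (ℤ.+ D)) ⟩
    (a ℤ.- m) ℤ.+ ℤ.+ D ℤ.- (b ℤ.- m) ℤ.- ℤ.+ D         ≡⟨ cong₂ (λ x y → x ℤ.+ ℤ.+ D ℤ.- y ℤ.- ℤ.+ D) (sym (+offset m≤a)) (sym (+offset (proj₁ b-range))) ⟩
    ℤ.+ offset a ℤ.+ ℤ.+ D ℤ.- ℤ.+ offset b ℤ.- ℤ.+ D   ≡⟨ cong (λ x → x ℤ.- ℤ.+ offset b ℤ.- ℤ.+ D) (sym (ℤ.pos-+ (offset a) D)) ⟩
    ℤ.+ (offset a + D) ℤ.- ℤ.+ offset b ℤ.- ℤ.+ D       ≡⟨ cong (ℤ._- ℤ.+ D) (ℤ.m-n≡m⊖n (offset a + D) (offset b)) ⟩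
    (offset a + D) ℤ.⊖ offset b ℤ.- ℤ.+ D              ≡⟨ cong (ℤ._- ℤ.+ D) (ℤ.⊖-≥ (≤-trans (offset≤D b-range) (m≤n+m D (offset a)))) ⟩
    ℤ.+ (offset a + D ∸ offset b) ℤ.- ℤ.+ D            ∎
    where
    open ≡-Reasoning
    shift : ∀ a b m d → (a ℤ.- m) ℤ.+ d ℤ.- (b ℤ.- m) ℤ.- d ≡ a ℤ.- b
    shift = ℤ-RingSolver.solve-∀

  unique-offsets : ∀ {xs} → All (m ℤ.≤_) xs → Unique xs → Unique (map offset xs)
  unique-offsets [] [] = []
  unique-offsets (m≤x ∷ m≤xs) (x∉xs ∷ u) =
    All.map⁺ (All.zipWith (λ (x≢y , m≤y) eq → x≢y (offset-injective m≤x m≤y eq)) (x∉xs , m≤xs)) ∷ unique-offsets m≤xs u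

  offset-difference≡∑ : ∀ (H : ℕ → ℕ) {a b} → InRange a → InRange b →
                        𝟙 (¬? (offset a ≟ offset b)) * H (offset a + D ∸ offset b)
                          ≡ ∑[ j < suc (D + D) ] (H j * 𝟙 (¬? (a ℤ.≟ b) ×-dec (a ℤ.- b ℤ.≟ shifted j)))
  offset-difference≡∑ H {a} {b} a∈ b∈ = by-cases (a ℤ.≟ b)
    where
    N : ℕ
    N = suc (D + D)
    P : ℕ → ℕ
    P j = 𝟙 (¬? (a ℤ.≟ b) ×-dec (a ℤ.- b ℤ.≟ shifted j))
    i₀ : ℕ
    i₀ = offset a + D ∸ offset b
    i₀<N : i₀ < N
    i₀<N = s≤s (≤-trans (m∸n≤m (offset a + D) (offset b)) (+-monoˡ-≤ D (offset≤D a∈)))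
    P≡[i₀,i₀+1[ : a ≢ b → ∀ j → [ i₀ , i₀ + 1 [ j ≡ P j
    P≡[i₀,i₀+1[ a≢b j = 𝟙-⇔ (i₀ ≤? j ×-dec j <? i₀ + 1) (¬? (a ℤ.≟ b) ×-dec (a ℤ.- b ℤ.≟ shifted j))
      (λ (i₀≤j , j<i₀+1) → a≢b , trans (difference≡ a∈ b∈) (cong shifted (≤-antisym i₀≤j (≤-pred (subst (j <_) (+-comm i₀ 1) j<i₀+1)))))
      (λ (_ , a-b≡j-D) → let i₀≡j = ℤ.+-injective (-‿cancelʳ-≡ (ℤ.+ D) (trans (sym (difference≡ a∈ b∈)) a-b≡j-D))
                         in ≤-reflexive i₀≡j , subst (_< i₀ + 1) i₀≡j (subst (i₀ <_) (+-comm 1 i₀) ≤-refl))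
    open ≡-Reasoning
    by-cases : Dec (a ≡ b) → 𝟙 (¬? (offset a ≟ offset b)) * H i₀ ≡ ∑[ j < N ] (H j * P j)
    by-cases (yes a≡b) = begin
      𝟙 (¬? (offset a ≟ offset b)) * H i₀    ≡⟨ cong (_* H i₀) (𝟙-no (¬? (offset a ≟ offset b)) (λ ne → ne (cong offset a≡b))) ⟩
      0                                      ≡⟨ sym (∑<-zero N (λ j _ → trans (cong (H j *_) (𝟙-no (¬? (a ℤ.≟ b) ×-dec (a ℤ.- b ℤ.≟ shifted j)) (λ (ne , _) → ne a≡b)))
                                                                             (*-zeroʳ (H j)))) ⟩
      ∑[ j < N ] (H j * P j)                 ∎
    by-cases (no a≢b) = begin
      𝟙 (¬? (offset a ≟ offset b)) * H i₀    ≡⟨ cong (_* H i₀) (𝟙-yes (¬? (offset a ≟ offset b)) (a≢b ∘ offset-injective (proj₁ a∈) (proj₁ b∈))) ⟩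
      1 * H i₀                               ≡⟨ *-identityˡ (H i₀) ⟩
      H i₀                                   ≡⟨ sym (∑<-point N i₀ H i₀<N) ⟩
      ∑[ j < N ] ([ i₀ , i₀ + 1 [ j * H j)   ≡⟨ ∑<-cong N (λ j _ → trans (*-comm _ (H j)) (cong (H j *_) (P≡[i₀,i₀+1[ a≢b j))) ⟩
      ∑[ j < N ] (H j * P j)                 ∎

  thin-offsets : ∀ {g} (A : List ℤ) → All InRange A → Thin g A → ∀ (H : ℕ → ℕ) →
                 ∑[ x ∈ map offset A ] ∑[ y ∈ map offset A ] (𝟙 (¬? (x ≟ y)) * H (x + D ∸ y)) ≤ g * ∑< (suc (D + D)) H
  thin-offsets {g} A in-range thin H = begin
    ∑[ x ∈ map offset A ] ∑[ y ∈ map offset A ] F x y     ≡⟨ ∑∈-map offset A (λ x → ∑[ y ∈ map offset A ] F x y) ⟩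
    ∑[ a ∈ A ] ∑[ y ∈ map offset A ] F (offset a) y        ≡⟨ ∑∈-cong′ A (λ a → ∑∈-map offset A (F (offset a))) ⟩
    ∑[ a ∈ A ] ∑[ b ∈ A ] F (offset a) (offset b)          ≡⟨ ∑∈-cong A (All.map (λ a∈ → ∑∈-cong A (All.map (offset-difference≡∑ H a∈) in-range)) in-range) ⟩
    ∑[ a ∈ A ] ∑[ b ∈ A ] ∑[ j < N ] (H j * P a b j)       ≡⟨ ∑∈-cong′ A (λ a → sym (∑<-∑∈-comm N A (λ j b → H j * P a b j))) ⟩
    ∑[ a ∈ A ] ∑[ j < N ] ∑[ b ∈ A ] (H j * P a b j)       ≡⟨ sym (∑<-∑∈-comm N A (λ j a → ∑[ b ∈ A ] (H j * P a b j))) ⟩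
    ∑[ j < N ] ∑[ a ∈ A ] ∑[ b ∈ A ] (H j * P a b j)       ≡⟨ ∑<-cong N (λ j _ → trans (∑∈-cong′ A (λ a → ∑∈-*ˡ A (H j) (λ b → P a b j)))
                                                                                          (∑∈-*ˡ A (H j) (λ a → ∑[ b ∈ A ] P a b j))) ⟩
    ∑[ j < N ] (H j * ∑[ a ∈ A ] ∑[ b ∈ A ] P a b j)       ≡⟨ ∑<-cong N (λ j _ → cong (H j *_) (sym (pairCount≡∑ A (shifted j)))) ⟩
    ∑[ j < N ] (H j * pairCount A (shifted j))             ≤⟨ ∑<-mono N (λ j _ → *-monoʳ-≤ (H j) (thin (shifted j))) ⟩
    ∑[ j < N ] (H j * g)                                   ≡⟨ trans (∑<-cong N (λ j _ → *-comm (H j) g)) (∑<-*ˡ N g H) ⟩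
    g * ∑< N H                                             ∎
    where
    open ≤-Reasoning
    N : ℕ
    N = suc (D + D)
    F : ℕ → ℕ → ℕ
    F x y = 𝟙 (¬? (x ≟ y)) * H (x + D ∸ y)
    P : ℤ → ℤ → ℕ → ℕ
    P a b j = 𝟙 (¬? (a ℤ.≟ b) ×-dec (a ℤ.- b ℤ.≟ shifted j))

  thinConfiguration : ∀ {g} (A : List ℤ) → Unique A → Thin g A → All InRange A → ThinConfiguration g D (map offset A)
  thinConfiguration A unique thin in-range = record
    { bounded = All.map⁺ (All.map offset≤D in-range)
    ; unique = unique-offsets (All.map proj₁ in-range) unique
    ; thin = thin-offsets A in-range thin
    }

-- Counting points in windows

countBelow : List ℕ → ℕ → ℕ
countBelow E t = ∑[ x ∈ E ] 𝟙 (x <? t)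

window : List ℕ → ℕ → ℕ → ℕ
window E v t = ∑[ x ∈ E ] [ suc x , suc x + v [ t

module _ (E : List ℕ) where

  window+countBelow : ∀ v t → window E v t + countBelow E (t ∸ v) ≡ countBelow E t
  window+countBelow v t = trans (sym (∑∈-distrib-+ E _ _)) (∑∈-cong′ E split)
    where
    open ≡-Reasoning
    split : ∀ x → [ suc x , suc x + v [ t + 𝟙 (x <? t ∸ v) ≡ 𝟙 (x <? t)
    split x with x <? t | suc x + v ≤? t
    ... | no x≮t | _ = begin
      [ suc x , suc x + v [ t + 𝟙 (x <? t ∸ v) ≡⟨ cong₂ _+_ ([,[-below (suc x) (suc x + v) (s≤s (≮⇒≥ x≮t)))
                                                            (𝟙-no (x <? t ∸ v) (x≮t ∘ x<t∸v⇒x<t)) ⟩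
      0                                          ≡⟨ sym (𝟙-no (x <? t) x≮t) ⟩
      𝟙 (x <? t)                                 ∎
      where
      x<t∸v⇒x<t : x < t ∸ v → x < t
      x<t∸v⇒x<t x<t∸v = <-≤-trans x<t∸v (m∸n≤m t v)
    ... | yes x<t | yes x+v<t = begin
      [ suc x , suc x + v [ t + 𝟙 (x <? t ∸ v) ≡⟨ cong₂ _+_ ([,[-above (suc x) (suc x + v) x+v<t)
                                                            (𝟙-yes (x <? t ∸ v) (m+n≤o⇒m≤o∸n (suc x) x+v<t)) ⟩
      1                                          ≡⟨ sym (𝟙-yes (x <? t) x<t) ⟩
      𝟙 (x <? t)                                 ∎
    ... | yes x<t | no x+v≮t = begin
      [ suc x , suc x + v [ t + 𝟙 (x <? t ∸ v) ≡⟨ cong₂ _+_ ([,[-inside (suc x) (suc x + v) x<t (≰⇒> x+v≮t))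
                                                            (𝟙-no (x <? t ∸ v) (≤⇒≯ t∸v≤x)) ⟩
      1                                          ≡⟨ sym (𝟙-yes (x <? t) x<t) ⟩
      𝟙 (x <? t)                                 ∎
      where
      t∸v≤x : t ∸ v ≤ x
      t∸v≤x = m≤n+o⇒m∸n≤o t v (subst (t ≤_) (+-comm x v) (≤-pred (≰⇒> x+v≮t)))

  window≤countBelow : ∀ v t → window E v t ≤ countBelow E t
  window≤countBelow v t = subst (window E v t ≤_) (window+countBelow v t) (m≤m+n _ _)

  window≡countBelow : ∀ v t → t ≤ v → window E v t ≡ countBelow E t
  window≡countBelow v t t≤v = begin
    window E v t                              ≡⟨ sym (+-identityʳ _) ⟩
    window E v t + 0                          ≡⟨ cong (window E v t +_) (sym nothing-below-0) ⟩
    window E v t + countBelow E (t ∸ v)       ≡⟨ window+countBelow v t ⟩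
    countBelow E t                            ∎
    where
    open ≡-Reasoning
    nothing-below-0 : countBelow E (t ∸ v) ≡ 0
    nothing-below-0 rewrite m≤n⇒m∸n≡0 t≤v = trans (∑∈-cong′ E (λ x → 𝟙-no (x <? 0) λ ())) (trans (∑∈-const E 0) (*-zeroʳ (length E)))

  countBelow-mono : ∀ {t t′} → t ≤ t′ → countBelow E t ≤ countBelow E t′
  countBelow-mono t≤t′ = ∑∈-mono E (All.universal (λ x → 𝟙-mono (x <? _) (x <? _) (λ x<t → <-≤-trans x<t t≤t′)) E)

windowOverlap : ℕ → ℕ → ℕ → ℕ
windowOverlap v x y = ∑[ i < v ] [ suc x , suc x + v [ (suc y + i)

windowOverlap-shift : ∀ v c x y → windowOverlap v (c + x) (c + y) ≡ windowOverlap v x y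
windowOverlap-shift v c x y = ∑<-cong v (λ i _ → trans (cong₂ (λ a b → [ a , b [ (suc (c + y) + i)) (sym (+-suc c x)) (suc-shift x v))
                                                  (trans (cong [ c + suc x , c + (suc x + v) [ (suc-shift y i))
                                                         ([,[-shift c (suc x) (suc x + v) (suc y + i))))
  where
  suc-shift : ∀ a b → suc (c + a) + b ≡ c + (suc a + b)
  suc-shift a b = trans (cong suc (+-assoc c a b)) (sym (+-suc c (a + b)))

windowOverlap-self : ∀ v x → windowOverlap v x x ≡ v
windowOverlap-self v x = begin
  windowOverlap v x x    ≡⟨ ∑<-cong v (λ i i<v → [,[-inside (suc x) (suc x + v) (m≤m+n (suc x) i) (+-monoʳ-< (suc x) i<v)) ⟩
  ∑[ i < v ] 1     ≡⟨ trans (∑<-const v 1) (*-identityʳ v) ⟩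
  v                ∎
  where open ≡-Reasoning

windowOverlap-diff : ∀ v D x y → y ≤ x + D → windowOverlap v x y ≡ windowOverlap v (x + D ∸ y) D
windowOverlap-diff v D x y y≤x+D = begin
  windowOverlap v x y                  ≡⟨ sym (windowOverlap-shift v D x y) ⟩
  windowOverlap v (D + x) (D + y)      ≡⟨ cong₂ (windowOverlap v) (trans (+-comm D x) (sym (m+[n∸m]≡n y≤x+D))) (+-comm D y) ⟩
  windowOverlap v (y + j) (y + D)      ≡⟨ windowOverlap-shift v y j D ⟩
  windowOverlap v j D                  ∎
  where
  open ≡-Reasoning
  j : ℕ
  j = x + D ∸ y

windowOverlap-split : ∀ v D x y → y ≤ x + D →
                      windowOverlap v x y ≡ 𝟙 (x ≟ y) * v + 𝟙 (¬? (x ≟ y)) * windowOverlap v (x + D ∸ y) D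
windowOverlap-split v D x y y≤x+D with x ≟ y
... | yes refl = begin
  windowOverlap v x x                                               ≡⟨ windowOverlap-self v x ⟩
  v                                                                 ≡⟨ sym (trans (+-identityʳ (1 * v)) (*-identityˡ v)) ⟩
  1 * v + 0 * O                                                     ≡⟨ cong₂ (λ a b → a * v + b * O) (sym (𝟙-yes (x ≟ x) refl))
                                                                                                    (sym (𝟙-no (¬? (x ≟ x)) (λ x≢x → x≢x refl))) ⟩
  𝟙 (x ≟ x) * v + 𝟙 (¬? (x ≟ x)) * O                                ∎
  where
  open ≡-Reasoning
  O : ℕ
  O = windowOverlap v (x + D ∸ x) D
... | no x≢y = begin
  windowOverlap v x y                                               ≡⟨ windowOverlap-diff v D x y y≤x+D ⟩
  O                                                                 ≡⟨ sym (*-identityˡ O) ⟩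
  0 * v + 1 * O                                                     ≡⟨ cong₂ (λ a b → a * v + b * O) (sym (𝟙-no (x ≟ y) x≢y))
                                                                                                    (sym (𝟙-yes (¬? (x ≟ y)) x≢y)) ⟩
  𝟙 (x ≟ y) * v + 𝟙 (¬? (x ≟ y)) * O                                ∎
  where
  open ≡-Reasoning
  O : ℕ
  O = windowOverlap v (x + D ∸ y) D

∑-windowOverlap : ∀ v D → v ≤ D → ∑[ j < suc (D + D) ] windowOverlap v j D ≡ v * v
∑-windowOverlap v D v≤D = begin
  ∑[ j < suc (D + D) ] windowOverlap v j D                                ≡⟨ ∑<-comm (suc (D + D)) v (λ j i → [ suc j , suc j + v [ (suc D + i)) ⟩
  ∑[ i < v ] ∑[ j < suc (D + D) ] [ suc j , suc j + v [ (suc D + i)  ≡⟨ ∑<-cong v windows-through ⟩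
  ∑[ i < v ] v                                                      ≡⟨ ∑<-const v v ⟩
  v * v                                                             ∎
  where
  open ≡-Reasoning
  windows-through : ∀ i → i < v → ∑[ j < suc (D + D) ] [ suc j , suc j + v [ (suc D + i) ≡ v
  windows-through i i<v = trans (∑<-cong (suc (D + D)) (λ j _ → window∋z j))
                                (∑<-[,[-count (suc (D + D)) (z ∸ v) v (≤-trans (≤-reflexive (m∸n+n≡m v≤z)) z≤)) 
    where
    z : ℕ
    z = suc D + i
    v≤z : v ≤ z
    v≤z = ≤-trans v≤D (≤-trans (n≤1+n D) (m≤m+n (suc D) i))
    z≤ : z ≤ suc (D + D)
    z≤ = s≤s (+-monoʳ-≤ D (≤-trans (<⇒≤ i<v) v≤D))
    window∋z : ∀ j → [ suc j , suc j + v [ z ≡ [ z ∸ v , z ∸ v + v [ j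
    window∋z j = 𝟙-⇔ (suc j ≤? z ×-dec z <? suc j + v) (z ∸ v ≤? j ×-dec j <? z ∸ v + v)
      (λ (j<z , z≤j+v) → m≤n+o⇒m∸n≤o z v (subst (z ≤_) (+-comm j v) (≤-pred z≤j+v)) , subst (j <_) (sym (m∸n+n≡m v≤z)) j<z)
      (λ (z∸v≤j , j<z) → subst (j <_) (m∸n+n≡m v≤z) j<z , s≤s (subst (_≤ j + v) (m∸n+n≡m v≤z) (+-monoˡ-≤ v z∸v≤j)))

module WindowCounts {g D : ℕ} {E : List ℕ} (cfg : ThinConfiguration g D E) where
  open ThinConfiguration cfg

  k : ℕ
  k = length E

  ∑-diagonal : ∀ c → ∑[ x ∈ E ] ∑[ y ∈ E ] (𝟙 (x ≟ y) * c) ≡ k * c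
  ∑-diagonal c = trans (∑∈-cong E (All.tabulate row)) (∑∈-const E c)
    where
    row : ∀ {x} → x ∈ E → ∑[ y ∈ E ] (𝟙 (x ≟ y) * c) ≡ c
    row {x} x∈E = trans (∑∈-*ʳ E c (λ y → 𝟙 (x ≟ y))) (trans (cong (_* c) (∑-𝟙≟-unique E unique x∈E)) (*-identityˡ c))

  k²≤k+g[1+2D] : k * k ≤ k + g * suc (D + D)
  k²≤k+g[1+2D] = begin
    k * k                                                               ≡⟨ sym all-pairs ⟩
    ∑[ x ∈ E ] ∑[ y ∈ E ] 1                                             ≡⟨ ∑∈-cong′ E (λ x → ∑∈-cong′ E (λ y → sym (split x y))) ⟩
    ∑[ x ∈ E ] ∑[ y ∈ E ] (𝟙 (x ≟ y) * 1 + 𝟙 (¬? (x ≟ y)) * 1)         ≡⟨ ∑∈-cong′ E (λ x → ∑∈-distrib-+ E _ _) ⟩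
    ∑[ x ∈ E ] (∑[ y ∈ E ] (𝟙 (x ≟ y) * 1) + ∑[ y ∈ E ] (𝟙 (¬? (x ≟ y)) * 1))
                                                                        ≡⟨ ∑∈-distrib-+ E _ _ ⟩
    ∑[ x ∈ E ] ∑[ y ∈ E ] (𝟙 (x ≟ y) * 1) + ∑[ x ∈ E ] ∑[ y ∈ E ] (𝟙 (¬? (x ≟ y)) * 1)
                                                                        ≤⟨ +-mono-≤ (≤-reflexive (trans (∑-diagonal 1) (*-identityʳ k))) (thin (λ _ → 1)) ⟩
    k + g * ∑[ j < suc (D + D) ] 1                                      ≡⟨ cong (λ n → k + g * n) (trans (∑<-const (suc (D + D)) 1) (*-identityʳ _)) ⟩
    k + g * suc (D + D)                                                 ∎
    where
    open ≤-Reasoning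
    all-pairs : ∑[ x ∈ E ] ∑[ y ∈ E ] 1 ≡ k * k
    all-pairs = trans (∑∈-cong′ E (λ _ → trans (∑∈-const E 1) (*-identityʳ k))) (∑∈-const E k)
    split : ∀ x y → 𝟙 (x ≟ y) * 1 + 𝟙 (¬? (x ≟ y)) * 1 ≡ 1
    split x y = trans (cong₂ _+_ (*-identityʳ (𝟙 (x ≟ y))) (*-identityʳ (𝟙 (¬? (x ≟ y))))) (𝟙+𝟙¬ (x ≟ y))

  ∑-window : ∀ v → ∑[ t < suc (D + v) ] window E v t ≡ k * v
  ∑-window v = begin
    ∑[ t < suc (D + v) ] ∑[ x ∈ E ] [ suc x , suc x + v [ t   ≡⟨ ∑<-∑∈-comm (suc (D + v)) E (λ t x → [ suc x , suc x + v [ t) ⟩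
    ∑[ x ∈ E ] ∑[ t < suc (D + v) ] [ suc x , suc x + v [ t   ≡⟨ ∑∈-cong E (All.map (λ x≤D → ∑<-[,[-count (suc (D + v)) _ v (s≤s (+-monoˡ-≤ v x≤D))) bounded) ⟩
    ∑[ x ∈ E ] v                                              ≡⟨ ∑∈-const E v ⟩
    k * v                                                     ∎
    where open ≡-Reasoning

  ∑-window² : ∀ v → v ≤ D → ∑[ t < suc (D + v) ] (window E v t * window E v t) ≤ k * v + g * (v * v)
  ∑-window² v v≤D = begin
    ∑[ t < T ] (W t * W t)                                                ≡⟨ ∑<-cong T (λ t _ → sym (∑∈-*ʳ E (W t) (λ y → [ suc y , suc y + v [ t))) ⟩
    ∑[ t < T ] ∑[ y ∈ E ] ([ suc y , suc y + v [ t * W t)                 ≡⟨ ∑<-∑∈-comm T E (λ t y → [ suc y , suc y + v [ t * W t) ⟩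
    ∑[ y ∈ E ] ∑[ t < T ] ([ suc y , suc y + v [ t * W t)                 ≡⟨ ∑∈-cong E (All.map (λ y≤D → ∑<-[,[ T _ v W (s≤s (+-monoˡ-≤ v y≤D))) bounded) ⟩
    ∑[ y ∈ E ] ∑[ i < v ] W (suc y + i)                                   ≡⟨ ∑∈-cong′ E (λ y → ∑<-∑∈-comm v E (λ i x → [ suc x , suc x + v [ (suc y + i))) ⟩
    ∑[ y ∈ E ] ∑[ x ∈ E ] windowOverlap v x y                             ≡⟨ ∑∈-comm E E (λ y x → windowOverlap v x y) ⟩
    ∑[ x ∈ E ] ∑[ y ∈ E ] windowOverlap v x y                             ≡⟨ ∑∈-cong′ E (λ x → ∑∈-cong E (All.map (λ y≤D → windowOverlap-split v D x _ (≤-trans y≤D (m≤n+m D x))) bounded)) ⟩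
    ∑[ x ∈ E ] ∑[ y ∈ E ] (𝟙 (x ≟ y) * v + 𝟙 (¬? (x ≟ y)) * H (x + D ∸ y)) ≡⟨ ∑∈-cong′ E (λ x → ∑∈-distrib-+ E _ _) ⟩
    ∑[ x ∈ E ] (∑[ y ∈ E ] (𝟙 (x ≟ y) * v) + ∑[ y ∈ E ] (𝟙 (¬? (x ≟ y)) * H (x + D ∸ y)))
                                                                          ≡⟨ ∑∈-distrib-+ E _ _ ⟩
    ∑[ x ∈ E ] ∑[ y ∈ E ] (𝟙 (x ≟ y) * v) + ∑[ x ∈ E ] ∑[ y ∈ E ] (𝟙 (¬? (x ≟ y)) * H (x + D ∸ y))
                                                                          ≤⟨ +-mono-≤ (≤-reflexive (∑-diagonal v)) (thin H) ⟩
    k * v + g * ∑< (suc (D + D)) H                                        ≡⟨ cong (λ n → k * v + g * n) (∑-windowOverlap v D v≤D) ⟩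
    k * v + g * (v * v)                                                   ∎
    where
    open ≤-Reasoning
    T : ℕ
    T = suc (D + v)
    W : ℕ → ℕ
    W = window E v
    H : ℕ → ℕ
    H = λ j → windowOverlap v j D

  deviation² : ℕ → ℕ → ℕ → ℕ → ℕ
  deviation² r w s t = ∣ r * window E w t - s ∣ * ∣ r * window E w t - s ∣

  squaredDeviation : ℕ → ℕ → ℕ → ℕ
  squaredDeviation r w s = ∑< (suc (D + w)) (deviation² r w s)

  variance-bound : ∀ r w s → w ≤ D →
                   squaredDeviation r w s + 2 * (r * (k * w) * s) ≤ r * r * (k * w + g * (w * w)) + suc (D + w) * (s * s)
  variance-bound r w s w≤D = begin
    squaredDeviation r w s + 2 * (r * (k * w) * s)                  ≡⟨ cong (λ z → squaredDeviation r w s + 2 * (r * z * s)) (sym (∑-window w)) ⟩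
    squaredDeviation r w s + 2 * (r * ∑< T W * s)                   ≡⟨ cong (squaredDeviation r w s +_) cross-terms ⟩
    squaredDeviation r w s + ∑[ t < T ] (2 * (r * W t * s))         ≡⟨ sym (∑<-distrib-+ T (λ t → ∣ r * W t - s ∣ * ∣ r * W t - s ∣) (λ t → 2 * (r * W t * s))) ⟩
    ∑[ t < T ] (∣ r * W t - s ∣ * ∣ r * W t - s ∣ + 2 * (r * W t * s)) ≡⟨ ∑<-cong T (λ t _ → ∣m-n∣²+2mn≡m²+n² (r * W t) s) ⟩
    ∑[ t < T ] (r * W t * (r * W t) + s * s)                        ≡⟨ ∑<-distrib-+ T (λ t → r * W t * (r * W t)) (λ _ → s * s) ⟩
    ∑[ t < T ] (r * W t * (r * W t)) + ∑[ t < T ] (s * s)           ≡⟨ cong₂ _+_ squares (∑<-const T (s * s)) ⟩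
    r * r * ∑[ t < T ] (W t * W t) + T * (s * s)                    ≤⟨ +-monoˡ-≤ (T * (s * s)) (*-monoʳ-≤ (r * r) (∑-window² w w≤D)) ⟩
    r * r * (k * w + g * (w * w)) + T * (s * s)                     ∎
    where
    open ≤-Reasoning
    T : ℕ
    T = suc (D + w)
    W : ℕ → ℕ
    W = window E w
    cross-terms : 2 * (r * ∑< T W * s) ≡ ∑[ t < T ] (2 * (r * W t * s))
    cross-terms = begin-equality
      2 * (r * ∑< T W * s)                ≡⟨ reorder r s (∑< T W) ⟩
      2 * r * s * ∑< T W                  ≡⟨ sym (∑<-*ˡ T (2 * r * s) W) ⟩
      ∑[ t < T ] (2 * r * s * W t)        ≡⟨ ∑<-cong T (λ t _ → sym (reorder r s (W t))) ⟩
      ∑[ t < T ] (2 * (r * W t * s))      ∎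
      where
      reorder : ∀ r s x → 2 * (r * x * s) ≡ 2 * r * s * x
      reorder = solve-∀
    squares : ∑[ t < T ] (r * W t * (r * W t)) ≡ r * r * ∑[ t < T ] (W t * W t)
    squares = trans (∑<-cong T (λ t _ → regroup r (W t))) (∑<-*ˡ T (r * r) (λ t → W t * W t))
      where
      regroup : ∀ r x → r * x * (r * x) ≡ r * r * (x * x)
      regroup = solve-∀

  -- Multiplied by g, the main terms of variance-bound form the square (s k - g r w)² = ρ².
  critical-variance : ∀ r w s ρ → w ≤ D → g * (r * w) + ρ ≡ s * k →
                      g * squaredDeviation r w s + s * k * (s * k) ≤ r * k * (g * (r * w)) + ρ * ρ + g * D * (s * s) + g * suc w * (s * s)
  critical-variance r w s ρ w≤D y+ρ≡sk = +-cancelʳ-≤ (y * y) _ _ (begin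
    g * SD + s * k * (s * k) + y * y                                   ≡⟨ +-assoc (g * SD) _ _ ⟩
    g * SD + (s * k * (s * k) + y * y)                                 ≡⟨ cong (g * SD +_) (z²+y²≡2zy+ρ² y+ρ≡sk) ⟩
    g * SD + (2 * (s * k) * y + ρ * ρ)                                 ≡⟨ trans (sym (+-assoc (g * SD) _ _)) (cong (_+ ρ * ρ) (scale-lhs g SD r k w s)) ⟩
    g * (SD + 2 * (r * (k * w) * s)) + ρ * ρ                           ≤⟨ +-monoˡ-≤ (ρ * ρ) (*-monoʳ-≤ g (variance-bound r w s w≤D)) ⟩
    g * (r * r * (k * w + g * (w * w)) + suc (D + w) * (s * s)) + ρ * ρ ≡⟨ scale-rhs g r k w D s ρ ⟩
    r * k * y + ρ * ρ + g * D * (s * s) + g * suc w * (s * s) + y * y   ∎)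
    where
    open ≤-Reasoning
    SD : ℕ
    SD = squaredDeviation r w s
    y : ℕ
    y = g * (r * w)
    scale-lhs : ∀ g SD r k w s → g * SD + 2 * (s * k) * (g * (r * w)) ≡ g * (SD + 2 * (r * (k * w) * s))
    scale-lhs = solve-∀
    scale-rhs : ∀ g r k w D s ρ → g * (r * r * (k * w + g * (w * w)) + suc (D + w) * (s * s)) + ρ * ρ
                ≡ r * k * (g * (r * w)) + ρ * ρ + g * D * (s * s) + g * suc w * (s * s) + g * (r * w) * (g * (r * w))
    scale-rhs = solve-∀

  squaredDeviation-≥ : ∀ r w s x L c → x + L ≤ suc (D + w) →
                       (∀ i → i < L → c ≤ ∣ r * window E w (x + i) - s ∣) → L * (c * c) ≤ squaredDeviation r w s
  squaredDeviation-≥ r w s x L c x+L≤T c≤ = ∑<-≥-interval (suc (D + w)) x L (deviation² r w s) (c * c) x+L≤T (λ i i<L → *-mono-≤ (c≤ i i<L) (c≤ i i<L))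

  squaredDeviation-≥₂ : ∀ r w s x y L c → x + L ≤ y → y + L ≤ suc (D + w) →
                        (∀ i → i < L → c ≤ ∣ r * window E w (x + i) - s ∣) → (∀ i → i < L → c ≤ ∣ r * window E w (y + i) - s ∣) →
                        2 * (L * (c * c)) ≤ squaredDeviation r w s
  squaredDeviation-≥₂ r w s x y L c x+L≤y y+L≤T c≤₁ c≤₂ =
    ∑<-≥-two-intervals (suc (D + w)) x y L (deviation² r w s) (c * c) x+L≤y y+L≤T
                       (λ i i<L → *-mono-≤ (c≤₁ i i<L) (c≤₁ i i<L)) (λ i i<L → *-mono-≤ (c≤₂ i i<L) (c≤₂ i i<L))

  deviation-if-sparse-start : ∀ s p a u → a ≤ u → countBelow E a + p < s → a * (p * p) ≤ squaredDeviation 1 u s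
  deviation-if-sparse-start s p a u a≤u sparse-start =
    squaredDeviation-≥ 1 u s 0 a p (≤-trans a≤u (≤-trans (m≤n+m u D) (n≤1+n (D + u)))) p≤dev
    where
    p≤dev : ∀ i → i < a → p ≤ ∣ 1 * window E u i - s ∣
    p≤dev i i<a = m+p≤n⇒p≤∣m-n∣ (≤-trans (+-monoˡ-≤ p W≤F[a]) (<⇒≤ sparse-start))
      where
      W≤F[a] : 1 * window E u i ≤ countBelow E a
      W≤F[a] = ≤-trans (≤-reflexive (*-identityˡ _)) (≤-trans (window≤countBelow E u i) (countBelow-mono E (<⇒≤ i<a)))

  deviation-if-dense-end : ∀ s p a u → a ≤ u → s + p < countBelow E (u ∸ a) → a * (p * p) ≤ squaredDeviation 1 u s
  deviation-if-dense-end s p a u a≤u dense-end =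
    squaredDeviation-≥ 1 u s (u ∸ a) a p (≤-trans (≤-reflexive (m∸n+n≡m a≤u)) (≤-trans (m≤n+m u D) (n≤1+n (D + u)))) p≤dev
    where
    p≤dev : ∀ i → i < a → p ≤ ∣ 1 * window E u (u ∸ a + i) - s ∣
    p≤dev i i<a = n+p≤m⇒p≤∣m-n∣ (begin
      s + p                         ≤⟨ <⇒≤ dense-end ⟩
      countBelow E (u ∸ a)          ≤⟨ countBelow-mono E (m≤m+n (u ∸ a) i) ⟩
      countBelow E (u ∸ a + i)      ≡⟨ sym (window≡countBelow E u (u ∸ a + i) t≤u) ⟩
      window E u (u ∸ a + i)        ≡⟨ sym (*-identityˡ _) ⟩
      1 * window E u (u ∸ a + i)    ∎)
      where
      open ≤-Reasoning
      t≤u : u ∸ a + i ≤ u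
      t≤u = ≤-trans (+-monoʳ-≤ (u ∸ a) (<⇒≤ i<a)) (≤-reflexive (m∸n+n≡m a≤u))

  deviation-if-sparse-after : ∀ s p a u → u + 2 * a ≤ suc (D + u) → s ≤ countBelow E a + p →
                              countBelow E (u + 2 * a) + 2 * p < 2 * s → a * (p * p) ≤ squaredDeviation 1 u s
  deviation-if-sparse-after s p a u u+2a≤T head sparse-after =
    squaredDeviation-≥ 1 u s (u + a) a p (≤-trans (≤-reflexive (u+a+a≡u+2a u a)) u+2a≤T) p≤dev
    where
    F : ℕ → ℕ
    F = countBelow E
    W : ℕ → ℕ
    W = window E u
    u+a+a≡u+2a : ∀ u a → u + a + a ≡ u + 2 * a
    u+a+a≡u+2a = solve-∀
    p≤dev : ∀ i → i < a → p ≤ ∣ 1 * W (u + a + i) - s ∣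
    p≤dev i i<a = m+p≤n⇒p≤∣m-n∣ (subst (λ z → z + p ≤ s) (sym (*-identityˡ _)) (<⇒≤ (+-cancelˡ-< s _ _ (begin-strict
      s + (W t + p)                 ≤⟨ +-monoˡ-≤ (W t + p) head ⟩
      F a + p + (W t + p)           ≡⟨ regroup (F a) p (W t) ⟩
      W t + F a + 2 * p             ≤⟨ +-monoˡ-≤ (2 * p) in-window ⟩
      F (u + 2 * a) + 2 * p         <⟨ sparse-after ⟩
      2 * s                         ≡⟨ cong (s +_) (+-identityʳ s) ⟩
      s + s                         ∎))))
      where
      open ≤-Reasoning
      t : ℕ
      t = u + a + i
      regroup : ∀ f p w → f + p + (w + p) ≡ w + f + 2 * p
      regroup = solve-∀
      t∸u≡a+i : t ∸ u ≡ a + i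
      t∸u≡a+i = trans (cong (_∸ u) (+-assoc u a i)) (m+n∸m≡n u (a + i))
      in-window : W t + F a ≤ F (u + 2 * a)
      in-window = begin
        W t + F a          ≤⟨ +-monoʳ-≤ (W t) (countBelow-mono E (≤-trans (m≤m+n a i) (≤-reflexive (sym t∸u≡a+i)))) ⟩
        W t + F (t ∸ u)    ≡⟨ window+countBelow E u t ⟩
        F t                ≤⟨ countBelow-mono E (≤-trans (+-monoʳ-≤ (u + a) (<⇒≤ i<a)) (≤-reflexive (u+a+a≡u+2a u a))) ⟩
        F (u + 2 * a)      ∎

  -- About s points of E lie in [0, a), at most 2p in [a, u - a), and about s more in [u - a, u + 2a).
  TwoClusters : ℕ → ℕ → ℕ → ℕ → Set
  TwoClusters s p a u = (s ≤ countBelow E a + p) × (countBelow E (u ∸ a) ≤ s + p) × (2 * s ≤ countBelow E (u + 2 * a) + 2 * p)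

  deviation-or-twoClusters : ∀ s p a u → a ≤ u → u + 2 * a ≤ suc (D + u) →
                             a * (p * p) ≤ squaredDeviation 1 u s ⊎ TwoClusters s p a u
  deviation-or-twoClusters s p a u a≤u u+2a≤T with suc (countBelow E a + p) ≤? s
  ... | yes sparse-start = inj₁ (deviation-if-sparse-start s p a u a≤u sparse-start)
  ... | no ¬sparse-start with suc (s + p) ≤? countBelow E (u ∸ a)
  ...   | yes dense-end = inj₁ (deviation-if-dense-end s p a u a≤u dense-end)
  ...   | no ¬dense-end with suc (countBelow E (u + 2 * a) + 2 * p) ≤? 2 * s
  ...     | yes sparse-after = inj₁ (deviation-if-sparse-after s p a u u+2a≤T (≤-pred (≰⇒> ¬sparse-start)) sparse-after)
  ...     | no ¬sparse-after = inj₂ (≤-pred (≰⇒> ¬sparse-start) , ≤-pred (≰⇒> ¬dense-end) , ≤-pred (≰⇒> ¬sparse-after))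

  clusters-deviation : ∀ s p a u w r → 3 * a ≤ w → w ≤ u → u ≤ D → TwoClusters s p a u →
                       2 * ((w ∸ 3 * a) * ((r * (s ∸ 3 * p) ∸ s) * (r * (s ∸ 3 * p) ∸ s))) ≤ squaredDeviation r w s
  clusters-deviation s p a u w r 3a≤w w≤u u≤D (head , gap , tail) =
    squaredDeviation-≥₂ r w s a (u + 2 * a) L _ a+L≤u+2a u+2a+L≤T (λ i i<L → β≤dev (a + i) (first i i<L)) (λ i i<L → β≤dev (u + 2 * a + i) (second i i<L))
    where
    F : ℕ → ℕ
    F = countBelow E
    L : ℕ
    L = w ∸ 3 * a
    a≤u : a ≤ u
    a≤u = ≤-trans (m≤n*m a 3) (≤-trans 3a≤w w≤u)
    w≡L+3a : L + 3 * a ≡ w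
    w≡L+3a = m∸n+n≡m 3a≤w
    a+L≤w : a + L ≤ w
    a+L≤w = ≤-trans (m≤m+n (a + L) (2 * a)) (≤-reflexive (trans (regroup a L) w≡L+3a))
      where
      regroup : ∀ a L → a + L + 2 * a ≡ L + 3 * a
      regroup = solve-∀
    u+2a+L≡u∸a+w : u + 2 * a + L ≡ u ∸ a + w
    u+2a+L≡u∸a+w = trans (cong (λ z → z + 2 * a + L) (sym (m∸n+n≡m a≤u))) (trans (regroup (u ∸ a) a L) (cong (u ∸ a +_) w≡L+3a))
      where
      regroup : ∀ x a L → x + a + 2 * a + L ≡ x + (L + 3 * a)
      regroup = solve-∀
    a+L≤u+2a : a + L ≤ u + 2 * a
    a+L≤u+2a = ≤-trans a+L≤w (≤-trans w≤u (m≤m+n u (2 * a)))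
    u+2a+L≤T : u + 2 * a + L ≤ suc (D + w)
    u+2a+L≤T = ≤-trans (≤-reflexive u+2a+L≡u∸a+w) (≤-trans (+-monoˡ-≤ w (≤-trans (m∸n≤m u a) u≤D)) (n≤1+n (D + w)))
    β≤dev : ∀ t → s ∸ 3 * p ≤ window E w t → r * (s ∸ 3 * p) ∸ s ≤ ∣ r * window E w t - s ∣
    β≤dev t s∸3p≤W = ≤-trans (∸-monoˡ-≤ s (*-monoʳ-≤ r s∸3p≤W)) (m∸n≤∣m-n∣ _ s)
    first : ∀ i → i < L → s ∸ 3 * p ≤ window E w (a + i)
    first i i<L = begin
      s ∸ 3 * p          ≤⟨ m≤n+o⇒m∸n≤o s (3 * p) (≤-trans head (≤-trans (+-monoʳ-≤ (F a) (m≤n*m p 3)) (≤-reflexive (+-comm (F a) (3 * p))))) ⟩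
      F a                ≤⟨ countBelow-mono E (m≤m+n a i) ⟩
      F (a + i)          ≡⟨ sym (window≡countBelow E w (a + i) (≤-trans (+-monoʳ-≤ a (<⇒≤ i<L)) a+L≤w)) ⟩
      window E w (a + i) ∎
      where open ≤-Reasoning
    second : ∀ i → i < L → s ∸ 3 * p ≤ window E w (u + 2 * a + i)
    second i i<L = m≤n+o⇒m∸n≤o s (3 * p) (+-cancelˡ-≤ (s + p) s _ (begin
      s + p + s                       ≡⟨ regroup s p ⟩
      2 * s + p                       ≤⟨ +-monoˡ-≤ p tail ⟩
      F (u + 2 * a) + 2 * p + p       ≤⟨ +-monoˡ-≤ p (+-monoˡ-≤ (2 * p) (countBelow-mono E (m≤m+n (u + 2 * a) i))) ⟩
      F t + 2 * p + p                 ≡⟨ cong (λ z → z + 2 * p + p) (sym (window+countBelow E w t)) ⟩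
      W′ + F (t ∸ w) + 2 * p + p      ≤⟨ +-monoˡ-≤ p (+-monoˡ-≤ (2 * p) (+-monoʳ-≤ W′ (≤-trans (countBelow-mono E t∸w≤u∸a) gap))) ⟩
      W′ + (s + p) + 2 * p + p        ≡⟨ regroup′ W′ s p ⟩
      s + p + (3 * p + W′)            ∎))
      where
      open ≤-Reasoning
      t : ℕ
      t = u + 2 * a + i
      W′ : ℕ
      W′ = window E w t
      t∸w≤u∸a : t ∸ w ≤ u ∸ a
      t∸w≤u∸a = m≤n+o⇒m∸n≤o t w (≤-trans (<⇒≤ (+-monoʳ-< (u + 2 * a) i<L)) (≤-reflexive (trans u+2a+L≡u∸a+w (+-comm (u ∸ a) w))))
      regroup : ∀ s p → s + p + s ≡ 2 * s + p
      regroup = solve-∀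
      regroup′ : ∀ w s p → w + (s + p) + 2 * p + p ≡ s + p + (3 * p + w)
      regroup′ = solve-∀

-- The deficit bound

-- With t = ⌊√k / q⌋, s = q t and v = ⌊s k / (b g)⌋, the critical windows have length b v and the
-- clusters are probed by windows of length α v, where r α = b.  The gain over the constant 2
-- is 1 / n; C₁ absorbs the lower-order terms of the first case and K₂ v t² is the squared deviation
-- forced by two clusters.
module DeficitBound (q b r α : ℕ) where

  N₁ : ℕ
  N₁ = b * (q * q)

  n : ℕ
  n = suc N₁

  C₁ : ℕ
  C₁ = N₁ * n * (3 * (q * q * q) + 1 + q * q) + n * (q * q)

  β : ℕ
  β = r * (q ∸ 3) ∸ q

  K₂ : ℕ
  K₂ = 2 * ((α ∸ 3) * (β * β))

  one-window-impossible : ∀ {g t k D v ρ} →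
    b * (g * v) + ρ ≡ q * t * k → ρ ≤ t → 1 ≤ t → t ≤ k → g ≤ k → k ≤ q * (t + 1) * (q * (t + 1)) →
    (n + N₁) * (q * t * k) + n * (g * D) ≤ n * (k * k) → C₁ < q * q * q * t →
    g * (v * (t * t)) + q * t * k * (q * t * k) ≤ k * (b * (g * v)) + ρ * ρ + g * D * (q * t * (q * t)) + (b * (g * v) + g) * (q * t * (q * t)) →
    ⊥
  one-window-impossible {g} {t} {k} {D} {v} {ρ} Y+ρ≡y ρ≤t 1≤t t≤k g≤k k≤ deficit C₁<q³t variance =
    <⇒≱ C₁<q³t (*-cancelʳ-≤ (q * q * q * t) C₁ Z {{>-nonZero Z≥1}} q³tZ≤C₁Z)
    where
    s² : ℕ
    s² = q * t * (q * t)
    y : ℕ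
    y = q * t * k
    Y : ℕ
    Y = b * (g * v)
    M : ℕ
    M = N₁ * n
    Z : ℕ
    Z = t * t * k
    Z≥1 : 0 < Z
    Z≥1 = *-mono-≤ (*-mono-≤ 1≤t 1≤t) (≤-trans 1≤t t≤k)
    Y≤y : Y ≤ y
    Y≤y = subst (Y ≤_) Y+ρ≡y (m≤m+n Y ρ)
    ρ≤k : ρ ≤ k
    ρ≤k = ≤-trans ρ≤t t≤k
    open ≤-Reasoning

    variance+deficit : n * (g * (v * (t * t))) + (n + N₁) * (y * s²) ≤ n * (k * Y) + n * (ρ * ρ) + n * ((Y + g) * s²)
    variance+deficit = +-cancelʳ-≤ (n * (y * y) + n * (g * D * s²)) _ _ (begin
      n * (g * (v * (t * t))) + (n + N₁) * (y * s²) + (n * (y * y) + n * (g * D * s²))  ≡⟨ regroup n N₁ (g * (v * (t * t))) y s² (g * D) ⟩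
      n * (g * (v * (t * t)) + y * y) + ((n + N₁) * y + n * (g * D)) * s²               ≤⟨ +-mono-≤ (*-monoʳ-≤ n variance) (*-monoˡ-≤ s² deficit) ⟩
      n * (k * Y + ρ * ρ + g * D * s² + (Y + g) * s²) + n * (k * k) * s²                ≡⟨ expand n k Y ρ (g * D) (Y + g) q t ⟩
      n * (k * Y) + n * (ρ * ρ) + n * ((Y + g) * s²) + (n * (y * y) + n * (g * D * s²))  ∎)
      where
      regroup : ∀ n N₁ a y S d → n * a + (n + N₁) * (y * S) + (n * (y * y) + n * (d * S)) ≡ n * (a + y * y) + ((n + N₁) * y + n * d) * S
      regroup = solve-∀
      expand : ∀ n k Y ρ d e q t → n * (k * Y + ρ * ρ + d * (q * t * (q * t)) + e * (q * t * (q * t))) + n * (k * k) * (q * t * (q * t))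
               ≡ n * (k * Y) + n * (ρ * ρ) + n * (e * (q * t * (q * t))) + (n * (q * t * k * (q * t * k)) + n * (d * (q * t * (q * t))))
      expand = solve-∀

    main-terms-cancelled : n * (g * (v * (t * t))) + N₁ * (y * s²) ≤ n * (k * y) + n * (ρ * ρ) + n * (g * s²)
    main-terms-cancelled = +-cancelʳ-≤ (n * (y * s²)) _ _ (begin
      n * (g * (v * (t * t))) + N₁ * (y * s²) + n * (y * s²)    ≡⟨ regroup n N₁ (g * (v * (t * t))) (y * s²) ⟩
      n * (g * (v * (t * t))) + (n + N₁) * (y * s²)             ≤⟨ variance+deficit ⟩
      n * (k * Y) + n * (ρ * ρ) + n * ((Y + g) * s²)            ≤⟨ +-mono-≤ (+-monoˡ-≤ _ (*-monoʳ-≤ n (*-monoʳ-≤ k Y≤y))) (*-monoʳ-≤ n (*-monoˡ-≤ s² (+-monoˡ-≤ g Y≤y))) ⟩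
      n * (k * y) + n * (ρ * ρ) + n * ((y + g) * s²)            ≡⟨ expand n (k * y) (ρ * ρ) y g s² ⟩
      n * (k * y) + n * (ρ * ρ) + n * (g * s²) + n * (y * s²)   ∎)
      where
      regroup : ∀ n N₁ a x → n * a + N₁ * x + n * x ≡ n * a + (n + N₁) * x
      regroup = solve-∀
      expand : ∀ n a b y g S → n * a + n * b + n * ((y + g) * S) ≡ n * a + n * b + n * (g * S) + n * (y * S)
      expand = solve-∀

    -- N₁ · g v t² = (y - ρ) s², so the deviation term pays for the 1 / N₁ that n = N₁ + 1 leaves.
    times-N₁ : y * s² + M * (y * s²) ≤ M * (k * y) + M * (ρ * ρ) + M * (g * s²) + n * (ρ * s²)
    times-N₁ = begin
      y * s² + M * (y * s²)                                          ≡⟨ regroup N₁ (y * s²) ⟩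
      n * (y * s²) + N₁ * (N₁ * (y * s²))                            ≡⟨ cong (λ z → n * (z * s²) + N₁ * (N₁ * (y * s²))) (sym Y+ρ≡y) ⟩
      n * ((Y + ρ) * s²) + N₁ * (N₁ * (y * s²))                      ≡⟨ unscale n b q g v t ρ (y * s²) ⟩
      N₁ * (n * (g * (v * (t * t))) + N₁ * (y * s²)) + n * (ρ * s²)  ≤⟨ +-monoˡ-≤ (n * (ρ * s²)) (*-monoʳ-≤ N₁ main-terms-cancelled) ⟩
      N₁ * (n * (k * y) + n * (ρ * ρ) + n * (g * s²)) + n * (ρ * s²) ≡⟨ distribute N₁ n (k * y) (ρ * ρ) (g * s²) (n * (ρ * s²)) ⟩
      M * (k * y) + M * (ρ * ρ) + M * (g * s²) + n * (ρ * s²)        ∎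
      where
      regroup : ∀ N₁ x → x + N₁ * suc N₁ * x ≡ suc N₁ * x + N₁ * (N₁ * x)
      regroup = solve-∀
      unscale : ∀ n b q g v t ρ x → n * ((b * (g * v) + ρ) * (q * t * (q * t))) + b * (q * q) * (b * (q * q) * x)
                ≡ b * (q * q) * (n * (g * (v * (t * t))) + b * (q * q) * x) + n * (ρ * (q * t * (q * t)))
      unscale = solve-∀
      distribute : ∀ N₁ n a b c d → N₁ * (n * a + n * b + n * c) + d ≡ N₁ * n * a + N₁ * n * b + N₁ * n * c + d
      distribute = solve-∀

    k-eliminated : y * s² ≤ M * (q * q * (2 * t + 1) * y) + M * (ρ * ρ) + M * (g * s²) + n * (ρ * s²)
    k-eliminated = +-cancelˡ-≤ (M * (y * s²)) _ _ (begin
      M * (y * s²) + y * s²                                                         ≡⟨ +-comm (M * (y * s²)) (y * s²) ⟩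
      y * s² + M * (y * s²)                                                         ≤⟨ times-N₁ ⟩
      M * (k * y) + M * (ρ * ρ) + M * (g * s²) + n * (ρ * s²)                       ≤⟨ +-monoˡ-≤ _ (+-monoˡ-≤ _ (+-monoˡ-≤ _ (*-monoʳ-≤ M (*-monoˡ-≤ y k≤)))) ⟩
      M * (q * (t + 1) * (q * (t + 1)) * y) + M * (ρ * ρ) + M * (g * s²) + n * (ρ * s²)
                                                                                    ≡⟨ expand M q t y (M * (ρ * ρ)) (M * (g * s²)) (n * (ρ * s²)) ⟩
      M * (y * s²) + (M * (q * q * (2 * t + 1) * y) + M * (ρ * ρ) + M * (g * s²) + n * (ρ * s²)) ∎)
      where
      expand : ∀ M q t y a b c → M * (q * (t + 1) * (q * (t + 1)) * y) + a + b + c ≡ M * (y * (q * t * (q * t))) + (M * (q * q * (2 * t + 1) * y) + a + b + c)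
      expand = solve-∀

    q³tZ≤C₁Z : q * q * q * t * Z ≤ C₁ * Z
    q³tZ≤C₁Z = begin
      q * q * q * t * Z                                                             ≡⟨ cube q t k ⟩
      y * s²                                                                        ≤⟨ k-eliminated ⟩
      M * (q * q * (2 * t + 1) * y) + M * (ρ * ρ) + M * (g * s²) + n * (ρ * s²)     ≤⟨ +-mono-≤ (+-mono-≤ (+-mono-≤ (*-monoʳ-≤ M boundary) (*-monoʳ-≤ M ρ²≤Z))
                                                                                                          (*-monoʳ-≤ M (*-monoˡ-≤ s² g≤k)))
                                                                                               (*-monoʳ-≤ n (*-monoˡ-≤ s² ρ≤k)) ⟩
      M * (3 * (q * q * q) * Z) + M * Z + M * (k * s²) + n * (k * s²)               ≡⟨ collect M n q t k ⟩
      C₁ * Z                                                                        ∎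
      where
      cube : ∀ q t k → q * q * q * t * (t * t * k) ≡ q * t * k * (q * t * (q * t))
      cube = solve-∀
      collect : ∀ M n q t k → M * (3 * (q * q * q) * (t * t * k)) + M * (t * t * k) + M * (k * (q * t * (q * t))) + n * (k * (q * t * (q * t)))
                ≡ (M * (3 * (q * q * q) + 1 + q * q) + n * (q * q)) * (t * t * k)
      collect = solve-∀
      boundary : q * q * (2 * t + 1) * y ≤ 3 * (q * q * q) * Z
      boundary = ≤-trans (*-monoˡ-≤ y (*-monoʳ-≤ (q * q) (+-monoʳ-≤ (2 * t) 1≤t))) (≤-reflexive (thrice q t k))
        where
        thrice : ∀ q t k → q * q * (2 * t + t) * (q * t * k) ≡ 3 * (q * q * q) * (t * t * k)
        thrice = solve-∀
      ρ²≤Z : ρ * ρ ≤ Z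
      ρ²≤Z = ≤-trans (*-mono-≤ ρ≤t ρ≤t) (m≤m*n (t * t) k {{>-nonZero (≤-trans 1≤t t≤k)}})

  two-clusters-impossible : ∀ {g t k D v ρ} →
    103 * (r * b * (q * q)) + 100 * ((α + 1) * (q * q)) + 100 < 100 * K₂ →
    b * (g * v) + ρ ≡ q * t * k → 1 ≤ g → 1 ≤ v → 100 ≤ t → ρ ≤ t → k ≤ q * (t + 1) * (q * (t + 1)) → g * D ≤ k * k →
    K₂ * (g * v * (t * t)) + q * t * k * (q * t * k) ≤ r * k * (b * (g * v)) + ρ * ρ + g * D * (q * t * (q * t)) + (α * (g * v) + g) * (q * t * (q * t)) →
    ⊥
  two-clusters-impossible {g} {t} {k} {D} {v} {ρ} separation Y+ρ≡y 1≤g 1≤v 100≤t ρ≤t k≤ gD≤k² variance =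
    <⇒≱ separation (*-cancelʳ-≤ (100 * K₂) _ X {{>-nonZero X≥1}} 100K₂X≤CX)
    where
    s² : ℕ
    s² = q * t * (q * t)
    X : ℕ
    X = g * v * (t * t)
    X≥1 : 0 < X
    X≥1 = *-mono-≤ (*-mono-≤ 1≤g 1≤v) (*-mono-≤ (≤-trans (s≤s z≤n) 100≤t) (≤-trans (s≤s z≤n) 100≤t))
    open ≤-Reasoning

    excess≤ : K₂ * X ≤ r * k * (b * (g * v)) + ρ * ρ + α * (q * q) * X + q * q * (g * (t * t))
    excess≤ = +-cancelʳ-≤ (q * t * k * (q * t * k)) _ _ (begin
      K₂ * X + q * t * k * (q * t * k)                                                         ≤⟨ variance ⟩
      r * k * (b * (g * v)) + ρ * ρ + g * D * s² + (α * (g * v) + g) * s²                      ≤⟨ +-monoˡ-≤ ((α * (g * v) + g) * s²) (+-monoʳ-≤ (r * k * (b * (g * v)) + ρ * ρ) (*-monoˡ-≤ s² gD≤k²)) ⟩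
      r * k * (b * (g * v)) + ρ * ρ + k * k * s² + (α * (g * v) + g) * s²                      ≡⟨ regroup (r * k * (b * (g * v)) + ρ * ρ) α g v k q t ⟩
      r * k * (b * (g * v)) + ρ * ρ + α * (q * q) * X + q * q * (g * (t * t)) + q * t * k * (q * t * k) ∎)
      where
      regroup : ∀ a α g v k q t → a + k * k * (q * t * (q * t)) + (α * (g * v) + g) * (q * t * (q * t))
                ≡ a + α * (q * q) * (g * v * (t * t)) + q * q * (g * (t * t)) + q * t * k * (q * t * k)
      regroup = solve-∀

    100K₂X≤CX : 100 * K₂ * X ≤ (103 * (r * b * (q * q)) + 100 * ((α + 1) * (q * q)) + 100) * X
    100K₂X≤CX = begin
      100 * K₂ * X                                                                             ≡⟨ *-assoc 100 K₂ X ⟩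
      100 * (K₂ * X)                                                                           ≤⟨ *-monoʳ-≤ 100 excess≤ ⟩
      100 * (r * k * (b * (g * v)) + ρ * ρ + α * (q * q) * X + q * q * (g * (t * t)))          ≤⟨ *-monoʳ-≤ 100 (+-monoˡ-≤ _ (+-monoˡ-≤ _ (+-monoˡ-≤ _
                                                                                                    (*-monoˡ-≤ (b * (g * v)) (*-monoʳ-≤ r k≤))))) ⟩
      100 * (r * (q * (t + 1) * (q * (t + 1))) * (b * (g * v)) + ρ * ρ + α * (q * q) * X + q * q * (g * (t * t)))
                                                                                               ≡⟨ expand r q t b g v (ρ * ρ) α ⟩
      100 * (r * b * (q * q)) * X + r * b * (q * q) * (100 * ((2 * t + 1) * (g * v))) + 100 * (ρ * ρ) + 100 * (α * (q * q)) * X + 100 * (q * q * (g * (t * t)))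
                                                                                               ≤⟨ +-mono-≤ (+-mono-≤ (+-mono-≤ (+-monoʳ-≤ (100 * (r * b * (q * q)) * X) (*-monoʳ-≤ (r * b * (q * q)) boundary))
                                                                                                                      (*-monoʳ-≤ 100 ρ²≤X)) (≤-refl {100 * (α * (q * q)) * X}))
                                                                                                           (*-monoʳ-≤ 100 (*-monoʳ-≤ (q * q) g[t²]≤X)) ⟩
      100 * (r * b * (q * q)) * X + r * b * (q * q) * (3 * X) + 100 * X + 100 * (α * (q * q)) * X + 100 * (q * q * X)
                                                                                               ≡⟨ collect (r * b * (q * q)) α q X ⟩
      (103 * (r * b * (q * q)) + 100 * ((α + 1) * (q * q)) + 100) * X                          ∎
      where
      expand : ∀ r q t b g v p α → 100 * (r * (q * (t + 1) * (q * (t + 1))) * (b * (g * v)) + p + α * (q * q) * (g * v * (t * t)) + q * q * (g * (t * t)))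
               ≡ 100 * (r * b * (q * q)) * (g * v * (t * t)) + r * b * (q * q) * (100 * ((2 * t + 1) * (g * v))) + 100 * p
                 + 100 * (α * (q * q)) * (g * v * (t * t)) + 100 * (q * q * (g * (t * t)))
      expand = solve-∀
      collect : ∀ c α q X → 100 * c * X + c * (3 * X) + 100 * X + 100 * (α * (q * q)) * X + 100 * (q * q * X)
                ≡ (103 * c + 100 * ((α + 1) * (q * q)) + 100) * X
      collect = solve-∀
      boundary : 100 * ((2 * t + 1) * (g * v)) ≤ 3 * X
      boundary = begin
        100 * ((2 * t + 1) * (g * v))   ≤⟨ *-monoʳ-≤ 100 (*-monoˡ-≤ (g * v) (+-monoʳ-≤ (2 * t) (≤-trans (s≤s z≤n) 100≤t))) ⟩
        100 * ((2 * t + t) * (g * v))   ≡⟨ thrice t (g * v) ⟩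
        3 * (g * v * (100 * t))         ≤⟨ *-monoʳ-≤ 3 (*-monoʳ-≤ (g * v) (*-monoˡ-≤ t 100≤t)) ⟩
        3 * X                           ∎
        where
        thrice : ∀ t x → 100 * ((2 * t + t) * x) ≡ 3 * (x * (100 * t))
        thrice = solve-∀
      ρ²≤X : ρ * ρ ≤ X
      ρ²≤X = ≤-trans (*-mono-≤ ρ≤t ρ≤t) (m≤n*m (t * t) (g * v) {{>-nonZero (*-mono-≤ 1≤g 1≤v)}})
      g[t²]≤X : g * (t * t) ≤ X
      g[t²]≤X = *-monoˡ-≤ (t * t) (m≤m*n g v {{>-nonZero 1≤v}})

  module Bounds (1≤q : 1 ≤ q) (3≤α : 3 ≤ α) (α≤b : α ≤ b) (2≤b : 2 ≤ b) (r*α≡b : r * α ≡ b)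
           (separation : 103 * (r * b * (q * q)) + 100 * ((α + 1) * (q * q)) + 100 < 100 * K₂) where

    threshold : ℕ → ℕ
    threshold g = C₁ + 100 + b * g

    module LargeDeficit {g D E} (cfg : ThinConfiguration g D E) (1≤g : 1 ≤ g) (t : ℕ) (t≥threshold : threshold g ≤ t)
                        (s²≤k : q * t * (q * t) ≤ length E) (k<[q[t+1]]² : length E < q * (t + 1) * (q * (t + 1)))
                        (deficit : (n + N₁) * (q * t * length E) + n * (g * D) ≤ n * (length E * length E)) where
      open WindowCounts cfg
      s : ℕ
      s = q * t
      y : ℕ
      y = q * t * k
      P : ℕ
      P = b * g
      1≤b : 1 ≤ b
      1≤b = ≤-trans (s≤s z≤n) 2≤b
      instance
        P≢0 : NonZero P
        P≢0 = >-nonZero (*-mono-≤ 1≤b 1≤g)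
      v : ℕ
      v = y / P
      ρ : ℕ
      ρ = y % P

      100≤t : 100 ≤ t
      100≤t = ≤-trans (m≤n+m 100 C₁) (≤-trans (m≤m+n (C₁ + 100) (b * g)) t≥threshold)
      1≤t : 1 ≤ t
      1≤t = ≤-trans (s≤s z≤n) 100≤t
      P≤t : P ≤ t
      P≤t = ≤-trans (m≤n+m P (C₁ + 100)) t≥threshold
      C₁<q³t : C₁ < q * q * q * t
      C₁<q³t = <-≤-trans (m<m+n C₁ (s≤s z≤n)) (≤-trans (≤-reflexive (sym (+-assoc C₁ 100 (b * g))))
                         (≤-trans t≥threshold (m≤n*m t (q * q * q) {{>-nonZero (*-mono-≤ (*-mono-≤ 1≤q 1≤q) 1≤q)}})))
      t≤s : t ≤ s
      t≤s = m≤n*m t q {{>-nonZero 1≤q}}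
      s≤k : s ≤ k
      s≤k = ≤-trans (m≤m*n s s {{>-nonZero (≤-trans 1≤t t≤s)}}) s²≤k
      t≤k : t ≤ k
      t≤k = ≤-trans t≤s s≤k
      g≤k : g ≤ k
      g≤k = ≤-trans (m≤n*m g b {{>-nonZero 1≤b}}) (≤-trans P≤t t≤k)
      k≤y : k ≤ y
      k≤y = m≤n*m k s {{>-nonZero (≤-trans 1≤t t≤s)}}

      Y+ρ≡y : b * (g * v) + ρ ≡ y
      Y+ρ≡y = sym (trans (m≡m%n+[m/n]*n y P) (reorder ρ v b g))
        where
        reorder : ∀ ρ v b g → ρ + v * (b * g) ≡ b * (g * v) + ρ
        reorder = solve-∀
      ρ≤t : ρ ≤ t
      ρ≤t = ≤-trans (<⇒≤ (m%n<n y P)) P≤t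
      1≤v : 1 ≤ v
      1≤v = m≥n⇒m/n>0 (≤-trans P≤t (≤-trans t≤k k≤y))
      gD≤k² : g * D ≤ k * k
      gD≤k² = *-cancelˡ-≤ n (≤-trans (m≤n+m (n * (g * D)) ((n + N₁) * y)) deficit)

      bv≤D : b * v ≤ D
      bv≤D = *-cancelˡ-≤ g {{>-nonZero 1≤g}} (*-cancelˡ-≤ 2 (+-cancelʳ-≤ (k + g) _ _ (begin
        2 * (g * (b * v)) + (k + g)   ≤⟨ +-monoˡ-≤ (k + g) (*-monoʳ-≤ 2 gbv≤y) ⟩
        2 * y + (k + g)               ≤⟨ +-monoʳ-≤ (2 * y) (+-mono-≤ k≤y (≤-trans g≤k k≤y)) ⟩
        2 * y + (y + y)               ≡⟨ four y ⟩
        4 * y                         ≤⟨ *-monoˡ-≤ y (≤-trans (≤-trans (s≤s (s≤s (s≤s (s≤s z≤n)))) 100≤t) t≤s) ⟩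
        s * y                         ≡⟨ sym (*-assoc s s k) ⟩
        s * s * k                     ≤⟨ *-monoˡ-≤ k s²≤k ⟩
        k * k                         ≤⟨ k²≤k+g[1+2D] ⟩
        k + g * suc (D + D)           ≡⟨ expand k g D ⟩
        2 * (g * D) + (k + g)         ∎)))
        where
        open ≤-Reasoning
        gbv≤y : g * (b * v) ≤ y
        gbv≤y = ≤-trans (≤-reflexive (swap g b v)) (subst (b * (g * v) ≤_) Y+ρ≡y (m≤m+n _ ρ))
          where
          swap : ∀ g b v → g * (b * v) ≡ b * (g * v)
          swap = solve-∀
        four : ∀ y → 2 * y + (y + y) ≡ 4 * y
        four = solve-∀
        expand : ∀ k g D → k + g * suc (D + D) ≡ 2 * (g * D) + (k + g)
        expand = solve-∀
      v≤bv : v ≤ b * v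
      v≤bv = m≤n*m v b {{>-nonZero 1≤b}}
      2v≤D : 2 * v ≤ D
      2v≤D = ≤-trans (*-monoˡ-≤ v 2≤b) bv≤D
      bv+2v≤T : b * v + 2 * v ≤ suc (D + b * v)
      bv+2v≤T = ≤-trans (+-monoʳ-≤ (b * v) 2v≤D) (≤-trans (≤-reflexive (+-comm (b * v) D)) (n≤1+n (D + b * v)))

      from-deviation : v * (t * t) ≤ squaredDeviation 1 (b * v) s → ⊥
      from-deviation deviation = one-window-impossible Y+ρ≡y ρ≤t 1≤t t≤k g≤k (<⇒≤ k<[q[t+1]]²) deficit C₁<q³t (begin
        g * (v * (t * t)) + y * y                                                           ≤⟨ +-monoˡ-≤ (y * y) (*-monoʳ-≤ g deviation) ⟩
        g * squaredDeviation 1 (b * v) s + y * y                                           ≤⟨ critical-variance 1 (b * v) s ρ bv≤D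
                                                                                                (trans (cong (_+ ρ) (reorder g b v)) Y+ρ≡y) ⟩
        1 * k * (g * (1 * (b * v))) + ρ * ρ + g * D * (s * s) + g * suc (b * v) * (s * s)  ≡⟨ normalise k g b v (ρ * ρ) (g * D * (s * s)) (s * s) ⟩
        k * (b * (g * v)) + ρ * ρ + g * D * (s * s) + (b * (g * v) + g) * (s * s)           ∎)
        where
        open ≤-Reasoning
        reorder : ∀ g b v → g * (1 * (b * v)) ≡ b * (g * v)
        reorder = solve-∀
        normalise : ∀ k g b v a c S → 1 * k * (g * (1 * (b * v))) + a + c + g * suc (b * v) * S ≡ k * (b * (g * v)) + a + c + (b * (g * v) + g) * S
        normalise = solve-∀

      from-twoClusters : TwoClusters s t v (b * v) → ⊥
      from-twoClusters clusters = two-clusters-impossible separation Y+ρ≡y 1≤g 1≤v 100≤t ρ≤t (<⇒≤ k<[q[t+1]]²) gD≤k² (begin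
        K₂ * (g * v * (t * t)) + y * y                                                      ≡⟨ cong (_+ y * y) gaps ⟩
        g * (2 * ((α * v ∸ 3 * v) * (β′ * β′))) + y * y                                     ≤⟨ +-monoˡ-≤ (y * y) (*-monoʳ-≤ g
                                                                                                (clusters-deviation s t v (b * v) (α * v) r (*-monoˡ-≤ v 3≤α) αv≤bv bv≤D clusters)) ⟩
        g * squaredDeviation r (α * v) s + y * y                                           ≤⟨ critical-variance r (α * v) s ρ (≤-trans αv≤bv bv≤D)
                                                                                                (trans (cong (_+ ρ) grαv≡bgv) Y+ρ≡y) ⟩
        r * k * (g * (r * (α * v))) + ρ * ρ + g * D * (s * s) + g * suc (α * v) * (s * s)  ≡⟨ cong₂ (λ x z → r * k * x + ρ * ρ + g * D * (s * s) + z)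
                                                                                                     grαv≡bgv (spread g α v (s * s)) ⟩
        r * k * (b * (g * v)) + ρ * ρ + g * D * (s * s) + (α * (g * v) + g) * (s * s)       ∎)
        where
        open ≤-Reasoning
        β′ : ℕ
        β′ = r * (s ∸ 3 * t) ∸ s
        αv≤bv : α * v ≤ b * v
        αv≤bv = *-monoˡ-≤ v α≤b
        grαv≡bgv : g * (r * (α * v)) ≡ b * (g * v)
        grαv≡bgv = trans (reorder g r α v) (cong (_* (g * v)) r*α≡b)
          where
          reorder : ∀ g r α v → g * (r * (α * v)) ≡ r * α * (g * v)
          reorder = solve-∀
        spread : ∀ g α v S → g * suc (α * v) * S ≡ (α * (g * v) + g) * S
        spread = solve-∀
        β′≡βt : β′ ≡ β * t
        β′≡βt = begin-equality
          r * (q * t ∸ 3 * t) ∸ q * t   ≡⟨ cong (λ z → r * z ∸ q * t) (sym (*-distribʳ-∸ t q 3)) ⟩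
          r * ((q ∸ 3) * t) ∸ q * t     ≡⟨ cong (_∸ q * t) (sym (*-assoc r (q ∸ 3) t)) ⟩
          r * (q ∸ 3) * t ∸ q * t       ≡⟨ sym (*-distribʳ-∸ t (r * (q ∸ 3)) q) ⟩
          β * t                         ∎
        gaps : K₂ * (g * v * (t * t)) ≡ g * (2 * ((α * v ∸ 3 * v) * (β′ * β′)))
        gaps = begin-equality
          K₂ * (g * v * (t * t))                              ≡⟨ regroup (α ∸ 3) β g v t ⟩
          g * (2 * ((α ∸ 3) * v * (β * t * (β * t))))          ≡⟨ cong₂ (λ x z → g * (2 * (x * (z * z)))) (*-distribʳ-∸ v α 3) (sym β′≡βt) ⟩
          g * (2 * ((α * v ∸ 3 * v) * (β′ * β′)))             ∎
          where
          regroup : ∀ a β g v t → 2 * (a * (β * β)) * (g * v * (t * t)) ≡ g * (2 * (a * v * (β * t * (β * t))))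
          regroup = solve-∀

      impossible : ⊥
      impossible = [ from-deviation , from-twoClusters ]′ (deviation-or-twoClusters s t v (b * v) v≤bv bv+2v≤T)

    K : ℕ → ℕ
    K g = q * threshold g * (q * threshold g)

    threshold≤t : ∀ {g k t} → K g ≤ k → k < q * (t + 1) * (q * (t + 1)) → threshold g ≤ t
    threshold≤t {g} {k} {t} K≤k k<[q[t+1]]² with threshold g ≤? t
    ... | yes threshold≤t = threshold≤t
    ... | no threshold≰t = contradiction (≤-trans (*-mono-≤ q[t+1]≤ q[t+1]≤) K≤k) (<⇒≱ k<[q[t+1]]²)
      where
      q[t+1]≤ : q * (t + 1) ≤ q * threshold g
      q[t+1]≤ = *-monoʳ-≤ q (subst (_≤ threshold g) (+-comm 1 t) (≰⇒> threshold≰t))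

    violation⇒deficit : ∀ {g D k t} → g * D ≤ k * k → q * t * (q * t) ≤ k →
                        (2 * n ∸ 1) * (2 * n ∸ 1) * k ^ 3 < n * (k * k ∸ g * D) * (n * (k * k ∸ g * D)) →
                        (n + N₁) * (q * t * k) + n * (g * D) ≤ n * (k * k)
    violation⇒deficit {g} {D} {k} {t} gD≤k² s²≤k violation = begin
      (n + N₁) * (q * t * k) + n * (g * D)     ≤⟨ +-monoˡ-≤ (n * (g * D)) (<⇒≤ (subst (λ c → c * (q * t * k) < n * (k * k ∸ g * D)) c≡n+N₁
                                                    (c²k³<L²⇒c[sk]<L (2 * n ∸ 1) (q * t) k (n * (k * k ∸ g * D)) s²≤k violation))) ⟩
      n * (k * k ∸ g * D) + n * (g * D)        ≡⟨ sym (*-distribˡ-+ n (k * k ∸ g * D) (g * D)) ⟩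
      n * (k * k ∸ g * D + g * D)              ≡⟨ cong (n *_) (m∸n+n≡m gD≤k²) ⟩
      n * (k * k)                              ∎
      where
      open ≤-Reasoning
      c≡n+N₁ : 2 * n ∸ 1 ≡ n + N₁
      c≡n+N₁ = trans (+-suc N₁ (N₁ + 0)) (cong (λ z → suc (N₁ + z)) (+-identityʳ N₁))

    thin-boundAt : ∀ {g D E} → ThinConfiguration g D E → 1 ≤ g → K g ≤ length E → BoundAt g n (length E) D
    thin-boundAt {g} {D} {E} cfg 1≤g K≤k with g * D ≤? length E * length E
    ... | no gD≰k² = inj₁ (+n*[+a-+b]≤0 n (<⇒≤ (≰⇒> gD≰k²)))
    ... | yes gD≤k² with n * (k * k ∸ g * D) * (n * (k * k ∸ g * D)) ≤? (2 * n ∸ 1) * (2 * n ∸ 1) * k ^ 3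
      where
      k : ℕ
      k = length E
    ...   | yes L²≤c²k³ rewrite +n*[+a-+b]≡+[n*[a∸b]] n gD≤k² = inj₂ (subst (ℤ._≤ _) (ℤ.pos-* L L) (ℤ.+≤+ L²≤c²k³))
      where
      L : ℕ
      L = n * (length E * length E ∸ g * D)
    ...   | no L²≰c²k³ with between-squares q 1≤q (length E)
    ...     | t , lower , upper =
      ⊥-elim (LargeDeficit.impossible cfg 1≤g t (threshold≤t K≤k upper) lower upper (violation⇒deficit {g} {D} gD≤k² lower (≰⇒> L²≰c²k³)))

    minimal-diameter-bound : ∀ g → 1 ≤ g → ∃ λ (K : ℕ) → ∀ (k D : ℕ) → K ≤ k → IsMinDiam g k D → BoundAt g n k D
    minimal-diameter-bound g 1≤g = K g , bound
      where
      bound : ∀ k D → K g ≤ k → IsMinDiam g k D → BoundAt g n k D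
      bound _ D K≤k ((A , unique , refl , thin , m , _ , _ , in-range) , _) =
        subst (λ k → BoundAt g n k D) (length-map offset A)
              (thin-boundAt (thinConfiguration A unique thin in-range) 1≤g (subst (K g ≤_) (sym (length-map offset A)) K≤k))
        where open Offsets m D

open DeficitBound 60 400 10 40 using (n)
open DeficitBound.Bounds 60 400 10 40 (≤ᵇ⇒≤ _ _ tt) (≤ᵇ⇒≤ _ _ tt) (≤ᵇ⇒≤ _ _ tt) (≤ᵇ⇒≤ _ _ tt) refl (≤ᵇ⇒≤ _ _ tt)
  using (minimal-diameter-bound)

theorem5 : ∀ (g : ℕ) → 1 ≤ g →
    ∃ λ (n : ℕ) → (1 ≤ n) × (∃ λ (K : ℕ) →
      ∀ (k D : ℕ) → K ≤ k → IsMinDiam g k D → BoundAt g n k D)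
theorem5 g 1≤g = n , s≤s z≤n , minimal-diameter-bound g 1≤g
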